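{- Let $n$ and $j$ be integers such that $0<n\le j$, let $i\in\mathbb{Z}$, and for each odd positive divisor $d\mid n$ let $r_d$ be the remainder of $j$ modulo $d$. Then $$\mathbf{S}^i_n(N(j))= \frac{1}{n}\sum_{\substack{d\mid n,\\ d \text{ odd}}}2^{\lfloor j/d \rfloor}\sum_{0\le s <d} \mathbf{S}^s_d(N(r_d))\, c_d(i-s).$$
   Context: For a non-negative integer $m$, $N(m)=\sum_{S\subseteq \{1,2,\ldots,m\}} x^{\sum S}\in\mathbb{Z}[x]$, where $\sum S$ is the sum of the elements of $S$ (so $N(0)=1$). For $f\in\mathbb{Z}[x]$, a positive integer $d$ and $s\in\mathbb{Z}$, $\mathbf{S}^s_d(f)=\sum_{t\equiv s\pmod d,\ t\ge 0}[x^t]f$, with $[x^t]f$ the coefficient of $x^t$; thus $\mathbf{S}^i_n(N(j))$ is the number of subsets of $\{1,\ldots,j\}$ whose sum is congruent to $i$ modulo $n$. For an integer $l$, the Ramanujan sum is $c_d(l)=\sum_{e\mid d,\ e\mid l}\mu(d/e)\,e$. -}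

module Defs where

open import Data.Nat as ℕ using (ℕ; zero; suc; _≤_; _<_)
open import Data.Nat.Divisibility using (_∣?_)
open import Data.Nat.Primality using (prime?)
open import Data.Integer as ℤ using (ℤ; +_; ∣_∣)
open import Data.List using (List; []; _∷_; _++_; map; foldr; filter; length; upTo; replicate)
import Data.List as L
open import Relation.Nullary.Decidable using (Dec; yes; no; ¬?; _×-dec_)
open import Data.Product using (_,_)
open import Data.Nat.ListAction using () renaming (sum to sumℕ)
open import Data.Bool using (if_then_else_; not)

-- Polynomials in ℤ[x] as coefficient lists, constant term first.
Poly : Set
Poly = List ℤ

_+ₚ_ : Poly → Poly → Poly
[]       +ₚ q        = q
p        +ₚ []       = p
(a ∷ p)  +ₚ (b ∷ q)  = (a ℤ.+ b) ∷ (p +ₚ q)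

monomial : ℕ → Poly
monomial k = replicate k (+ 0) ++ (+ 1 ∷ [])

coeff : Poly → ℕ → ℤ
coeff []      _       = + 0
coeff (a ∷ f) zero    = a
coeff (a ∷ f) (suc t) = coeff f t

sumℤ : List ℤ → ℤ
sumℤ = foldr ℤ._+_ (+ 0)

subsets : ℕ → List (List ℕ)
subsets zero    = [] ∷ []
subsets (suc m) = subsets m ++ map (suc m ∷_) (subsets m)

N : ℕ → Poly
N m = foldr _+ₚ_ [] (map (λ S → monomial (sumℕ S)) (subsets m))

-- 𝐒^s_d(f) = Σ_{t ≥ 0, t ≡ s (mod d)} [x^t] f  (coefficients beyond length f vanish)
𝐒 : ℕ → ℤ → Poly → ℤ
𝐒 d s f = sumℤ (map (coeff f) (filter (λ t → d ∣? ∣ (+ t) ℤ.- s ∣) (upTo (length f))))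

divisors : ℕ → List ℕ
divisors n = filter (λ e → e ∣? n) (map suc (upTo n))

μ : ℕ → ℤ
μ n = if hasSquare then + 0
      else (ℤ.- (+ 1)) ℤ.^ length (filter (λ p → prime? p ×-dec (p ∣? n)) (upTo (suc n)))
  where
  hasSquare = not (length (filter (λ k → (k ℕ.* k) ∣? n) (map (λ k → suc (suc k)) (upTo n))) ℕ.≡ᵇ 0)

-- natural-number quotient, only used with a positive divisor
_div_ : ℕ → ℕ → ℕ
a div zero    = 0
a div (suc k) = a ℕ./ suc k

-- remainder, only used with a positive modulus
_mod_ : ℕ → ℕ → ℕ
a mod zero    = a
a mod (suc k) = a ℕ.% suc k

c : ℕ → ℤ → ℤ
c d l = sumℤ (map (λ e → μ (d div e) ℤ.* (+ e)) (filter (λ e → e ∣? ∣ l ∣) (divisors d)))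

oddDivisors : ℕ → List ℕ
oddDivisors n = filter (λ d → ¬? (2 ∣? d)) (divisors n)

module Submission where

-- Write Σ⊆ j g i = Σ_{S ⊆ {1,…,j}} g (i - ΣS).  Reading 𝐒ⁱ_n(N j) as N j
-- evaluated against the indicator of t ≡ i (mod n), and expanding
-- n [n ∣ l] = Σ_{d ∣ n} c_d(l) (orthogonality of Ramanujan sums, from
-- Σ_{e ∣ m} μ e = [m = 1]), gives n 𝐒ⁱ_n(N j) = Σ_{d ∣ n} Σ⊆ j c_d i.
-- Each c_d is d-periodic and balanced: Σ_{m<p} c_d(i - m d/p) = 0 for every
-- prime p ∣ d.  For even d this makes c_d antiperiodic with antiperiod
-- d/2 ≤ j, so its term vanishes.  For odd d, grading subsets by size and
-- rotating {1,…,d} gives Σ⊆ d c_d = 2 c_d, hence Σ⊆ j c_d = 2^⌊j/d⌋ Σ⊆ (j mod d) c_d,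
-- and periodicity turns Σ⊆ (j mod d) c_d into the inner sum of the theorem.

open import Defs
open import Data.Nat using (ℕ; _<_; _≤_)
open import Data.Integer using (ℤ; +_; _*_; _-_; _^_)
open import Data.List using (map; upTo)
open import Relation.Binary.PropositionalEquality using (_≡_)

open import Data.Nat as ℕ using (zero; suc; z≤n; s≤s)
import Data.Nat.Properties as ℕP
open import Data.Nat.Divisibility as ND using (_∣_; divides; _∣?_)
open import Data.Nat.DivMod using (m*n/n≡m; m≡m%n+[m/n]*n; m%n<n)
open import Data.Nat.GCD using (gcd; gcd-GCD; gcd[m,n]∣m; gcd[m,n]∣n; module Bézout)
open import Data.Nat.Coprimality using (Coprime; coprime-Bézout; coprime-divisor)
open import Data.Nat.Primality
  using (Prime; prime?; prime[2]; euclidsLemma; prime⇒irreducible; prime⇒nonZero; ¬prime[0]; ¬prime[1])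
open import Data.Nat.Primality.Factorisation using (factorise)
open import Data.Nat.ListAction using (product) renaming (sum to sumℕ)
open import Data.Nat.Tactic.RingSolver using () renaming (solve-∀ to solveℕ-∀)
open import Data.Integer as ℤ using (0ℤ; 1ℤ; _+_; -_)
import Data.Integer.Properties as ℤP
open import Data.Integer.DivMod using (a≡a%n+[a/n]*n; n%d<d)
import Data.Integer.Divisibility.Signed as Signed
open import Data.Integer.Tactic.RingSolver using (solve-∀)
open import Relation.Binary.PropositionalEquality
open import Relation.Nullary using (Dec; yes; no; ¬_; ¬?; _×-dec_)
open import Relation.Unary using (Pred; Decidable)
open import Data.List using (List; []; _∷_; _++_; foldr; filter; length; applyUpTo)
import Data.List.Properties as LP
open import Data.List.Relation.Unary.All using (All; []; _∷_)
open import Data.Bool using (if_then_else_; not)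
open import Data.Product using (Σ; _×_; _,_; proj₁; proj₂)
open import Data.Sum using (inj₁; inj₂)
open import Data.Empty using (⊥-elim)
open import Function using (_∘_)

Σ< : ℕ → (ℕ → ℤ) → ℤ
Σ< zero    f = 0ℤ
Σ< (suc n) f = f 0 + Σ< n (λ k → f (suc k))

𝟙 : ∀ {a} {P : Set a} → Dec P → ℤ
𝟙 (yes _) = 1ℤ
𝟙 (no _)  = 0ℤ

𝟙-iff : ∀ {a b} {P : Set a} {Q : Set b} → (P → Q) → (Q → P) → (p : Dec P) (q : Dec Q) → 𝟙 p ≡ 𝟙 q
𝟙-iff f g (yes _) (yes _) = refl
𝟙-iff f g (yes p) (no ¬q) = ⊥-elim (¬q (f p))
𝟙-iff f g (no ¬p) (yes q) = ⊥-elim (¬p (g q))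
𝟙-iff f g (no _)  (no _)  = refl

𝟙-yes : ∀ {a} {P : Set a} → P → (p : Dec P) → 𝟙 p ≡ 1ℤ
𝟙-yes x (yes _) = refl
𝟙-yes x (no ¬x) = ⊥-elim (¬x x)

𝟙-no : ∀ {a} {P : Set a} → ¬ P → (p : Dec P) → 𝟙 p ≡ 0ℤ
𝟙-no ¬x (yes x) = ⊥-elim (¬x x)
𝟙-no ¬x (no _)  = refl

𝟙-compl : ∀ {a} {P : Set a} (p : Dec P) → 𝟙 p + 𝟙 (¬? p) ≡ 1ℤ
𝟙-compl (yes _) = refl
𝟙-compl (no _)  = refl

𝟙-no-* : ∀ {a} {P : Set a} → ¬ P → (p : Dec P) (x : ℤ) → 𝟙 p * x ≡ 0ℤ
𝟙-no-* ¬x p x = trans (cong (_* x) (𝟙-no ¬x p)) (ℤP.*-zeroˡ x)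

*-vanishʳ : ∀ a {b} → b ≡ 0ℤ → a * b ≡ 0ℤ
*-vanishʳ a refl = ℤP.*-zeroʳ a

+-congˡ : ∀ a {b c : ℤ} → b ≡ c → a + b ≡ a + c
+-congˡ a = cong (λ z → a + z)

+-congʳ : ∀ a {b c : ℤ} → b ≡ c → b + a ≡ c + a
+-congʳ a = cong (λ z → z + a)

interchange : ∀ a b c d → (a + b) + (c + d) ≡ (a + c) + (b + d)
interchange = solve-∀

Σ-cong : ∀ n {f g : ℕ → ℤ} → (∀ k → f k ≡ g k) → Σ< n f ≡ Σ< n g
Σ-cong zero    eq = refl
Σ-cong (suc n) eq = cong₂ _+_ (eq 0) (Σ-cong n (λ k → eq (suc k)))

Σ-cong< : ∀ n {f g : ℕ → ℤ} → (∀ k → k < n → f k ≡ g k) → Σ< n f ≡ Σ< n g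
Σ-cong< zero    eq = refl
Σ-cong< (suc n) eq = cong₂ _+_ (eq 0 (s≤s z≤n)) (Σ-cong< n (λ k k<n → eq (suc k) (s≤s k<n)))

Σ-+ : ∀ n (f g : ℕ → ℤ) → Σ< n (λ k → f k + g k) ≡ Σ< n f + Σ< n g
Σ-+ zero    f g = refl
Σ-+ (suc n) f g = trans (+-congˡ (f 0 + g 0) (Σ-+ n _ _)) (interchange (f 0) (g 0) _ _)

Σ-* : ∀ n a (f : ℕ → ℤ) → Σ< n (λ k → a * f k) ≡ a * Σ< n f
Σ-* zero    a f = sym (ℤP.*-zeroʳ a)
Σ-* (suc n) a f = trans (+-congˡ (a * f 0) (Σ-* n a _)) (sym (ℤP.*-distribˡ-+ a (f 0) _))

Σ-*ʳ : ∀ n a (f : ℕ → ℤ) → Σ< n (λ k → f k * a) ≡ Σ< n f * a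
Σ-*ʳ n a f = trans (Σ-cong n (λ k → ℤP.*-comm (f k) a)) (trans (Σ-* n a f) (ℤP.*-comm a _))

Σ-neg : ∀ n (f : ℕ → ℤ) → Σ< n (λ k → - f k) ≡ - Σ< n f
Σ-neg n f = trans (Σ-cong n (λ k → sym (ℤP.-1*i≡-i (f k)))) (trans (Σ-* n (- 1ℤ) f) (ℤP.-1*i≡-i _))

Σ-const : ∀ n a → Σ< n (λ _ → a) ≡ + n * a
Σ-const zero    a = sym (ℤP.*-zeroˡ a)
Σ-const (suc n) a = trans (+-congˡ a (Σ-const n a)) (trans (lemma a (+ n)) (cong (_* a) (sym (ℤP.pos-+ 1 n))))
  where
  lemma : ∀ x y → x + y * x ≡ (1ℤ + y) * x
  lemma = solve-∀

Σ-zero : ∀ n {f : ℕ → ℤ} → (∀ k → f k ≡ 0ℤ) → Σ< n f ≡ 0ℤ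
Σ-zero n eq = trans (Σ-cong n eq) (trans (Σ-const n 0ℤ) (ℤP.*-zeroʳ (+ n)))

Σ-zero< : ∀ n {f : ℕ → ℤ} → (∀ k → k < n → f k ≡ 0ℤ) → Σ< n f ≡ 0ℤ
Σ-zero< n eq = trans (Σ-cong< n eq) (Σ-zero n (λ _ → refl))

Σ-last : ∀ n (f : ℕ → ℤ) → Σ< (suc n) f ≡ Σ< n f + f n
Σ-last zero    f = trans (ℤP.+-identityʳ (f 0)) (sym (ℤP.+-identityˡ (f 0)))
Σ-last (suc n) f = trans (+-congˡ (f 0) (Σ-last n (λ k → f (suc k)))) (sym (ℤP.+-assoc (f 0) _ _))

Σ-split : ∀ a b (f : ℕ → ℤ) → Σ< (a ℕ.+ b) f ≡ Σ< a f + Σ< b (λ k → f (a ℕ.+ k))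
Σ-split zero    b f = sym (ℤP.+-identityˡ _)
Σ-split (suc a) b f = trans (+-congˡ (f 0) (Σ-split a b (λ k → f (suc k)))) (sym (ℤP.+-assoc (f 0) _ _))

Σ-swap : ∀ a b (F : ℕ → ℕ → ℤ) → Σ< a (λ x → Σ< b (F x)) ≡ Σ< b (λ y → Σ< a (λ x → F x y))
Σ-swap zero    b F = sym (Σ-zero b (λ _ → refl))
Σ-swap (suc a) b F = trans (+-congˡ (Σ< b (F 0)) (Σ-swap a b (λ x → F (suc x)))) (sym (Σ-+ b (F 0) _))

Σ-delta : ∀ n r (F : ℕ → ℤ) → r < n → Σ< n (λ k → 𝟙 (k ℕ.≟ r) * F k) ≡ F r
Σ-delta (suc n) zero F _ =
  trans (cong₂ _+_ (ℤP.*-identityˡ (F 0)) (Σ-zero n (λ k → 𝟙-no-* (λ ()) (suc k ℕ.≟ 0) (F (suc k)))))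
        (ℤP.+-identityʳ (F 0))
Σ-delta (suc n) (suc r) F (s≤s r<n) =
  trans (cong₂ _+_ (𝟙-no-* (λ ()) (0 ℕ.≟ suc r) (F 0))
          (trans (Σ-cong n (λ k → cong (_* F (suc k)) (𝟙-iff ℕP.suc-injective (cong suc) (suc k ℕ.≟ suc r) (k ℕ.≟ r))))
                 (Σ-delta n r (λ k → F (suc k)) r<n)))
        (ℤP.+-identityˡ _)

Σ-extend : ∀ n n' (f : ℕ → ℤ) → n ≤ n' → (∀ k → n ≤ k → f k ≡ 0ℤ) → Σ< n' f ≡ Σ< n f
Σ-extend n n' f n≤n' vanish with ℕP.m≤n⇒∃[o]m+o≡n n≤n'
... | o , refl = trans (Σ-split n o f)
                   (trans (+-congˡ (Σ< n f) (Σ-zero o (λ k → vanish (n ℕ.+ k) (ℕP.m≤m+n n k)))) (ℤP.+-identityʳ _))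

prime≥2 : ∀ {p} → Prime p → 2 ≤ p
prime≥2 {zero}          pp = ⊥-elim (¬prime[0] pp)
prime≥2 {suc zero}      pp = ⊥-elim (¬prime[1] pp)
prime≥2 {suc (suc p)} _ = s≤s (s≤s z≤n)

prime-factor : ∀ t → 2 ≤ t → Σ ℕ (λ p → Prime p × p ∣ t)
prime-factor (suc zero) (s≤s ())
prime-factor t@(suc (suc _)) _ with factorise t
... | record { factors = [] ; isFactorisation = () }
... | record { factors = p ∷ ps ; isFactorisation = eq ; factorsPrime = pp ∷ _ } =
  p , pp , divides (product ps) (trans eq (ℕP.*-comm p (product ps)))

prime-cancel : ∀ {p} → Prime p → ∀ x → + p * x ≡ 0ℤ → x ≡ 0ℤ
prime-cancel {zero}  pp x eq = ⊥-elim (¬prime[0] pp)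
prime-cancel {suc p} pp x eq = ℤP.*-cancelˡ-≡ (+ suc p) x 0ℤ (trans eq (sym (ℤP.*-zeroʳ (+ suc p))))

prime-coprime : ∀ {p x} → Prime p → ¬ p ∣ x → Coprime x p
prime-coprime pp ¬p∣x (i∣x , i∣p) with prime⇒irreducible pp i∣p
... | inj₁ i≡1  = i≡1
... | inj₂ refl = ⊥-elim (¬p∣x i∣x)

coprime-mul : ∀ {p k m} → Prime p → ¬ p ∣ k → p ∣ m → k ∣ m → p ℕ.* k ∣ m
coprime-mul {p} {k} pp ¬p∣k p∣m (divides t eq) with euclidsLemma t k pp (subst (p ∣_) eq p∣m)
... | inj₂ p∣k = ⊥-elim (¬p∣k p∣k)
... | inj₁ (divides t' refl) = divides t' (trans eq (ℕP.*-assoc t' p k))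

0∤ : ∀ {n} → 1 ≤ n → ¬ 0 ∣ n
0∤ 1≤n 0∣n with ND.0∣⇒≡0 0∣n
0∤ () 0∣n | refl

divisor-pos : ∀ {d n} → 1 ≤ n → d ∣ n → 1 ≤ d
divisor-pos {zero}  1≤n d∣n = ⊥-elim (0∤ 1≤n d∣n)
divisor-pos {suc _} _   _   = s≤s z≤n

factor-pos : ∀ {n} q e → 1 ≤ n → n ≡ q ℕ.* e → 1 ≤ q
factor-pos zero    e 1≤n eq = ⊥-elim (ℕP.<⇒≢ 1≤n (sym eq))
factor-pos (suc _) e _   _  = s≤s z≤n

≢1⇒≥2 : ∀ {m} → 1 ≤ m → m ≢ 1 → 2 ≤ m
≢1⇒≥2 {suc zero}    _ ne = ⊥-elim (ne refl)
≢1⇒≥2 {suc (suc _)} _ _  = s≤s (s≤s z≤n)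

∤-large : ∀ {n k} → 1 ≤ n → n < k → ¬ k ∣ n
∤-large 1≤n n<k k∣n = ℕP.<⇒≱ n<k (ND.∣⇒≤ {{ℕ.>-nonZero 1≤n}} k∣n)

small-multiple : ∀ {p k} → k < p → p ∣ k → k ≡ 0
small-multiple {p} {zero}  _   _   = refl
small-multiple {p} {suc k} k<p p∣k = ⊥-elim (ℕP.<⇒≱ k<p (ND.∣⇒≤ p∣k))

div-exact : ∀ a b → 1 ≤ b → (a ℕ.* b) div b ≡ a
div-exact a (suc b) _ = m*n/n≡m a (suc b)

∣-abs-+ : ∀ {e} a b → e ∣ ℤ.∣ a ∣ → e ∣ ℤ.∣ b ∣ → e ∣ ℤ.∣ a + b ∣
∣-abs-+ {e} a b h₁ h₂ =
  Signed.∣⇒∣ᵤ {+ e} {a + b} (Signed.∣m∣n⇒∣m+n {+ e} {a} {b} (Signed.∣ᵤ⇒∣ {+ e} {a} h₁) (Signed.∣ᵤ⇒∣ {+ e} {b} h₂))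

∣-abs-- : ∀ {e} a b → e ∣ ℤ.∣ a ∣ → e ∣ ℤ.∣ b ∣ → e ∣ ℤ.∣ a - b ∣
∣-abs-- {e} a b h₁ h₂ =
  Signed.∣⇒∣ᵤ {+ e} {a - b} (Signed.∣m∣n⇒∣m-n {+ e} {a} {b} (Signed.∣ᵤ⇒∣ {+ e} {a} h₁) (Signed.∣ᵤ⇒∣ {+ e} {b} h₂))

∣-abs-* : ∀ {e} a b → e ∣ ℤ.∣ b ∣ → e ∣ ℤ.∣ a * b ∣
∣-abs-* {e} a b h = Signed.∣⇒∣ᵤ {+ e} {a * b} (Signed.∣n⇒∣m*n {+ e} a {b} (Signed.∣ᵤ⇒∣ {+ e} {b} h))

sumℤ-++ : ∀ xs ys → sumℤ (xs ++ ys) ≡ sumℤ xs + sumℤ ys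
sumℤ-++ []       ys = sym (ℤP.+-identityˡ _)
sumℤ-++ (x ∷ xs) ys = trans (+-congˡ x (sumℤ-++ xs ys)) (sym (ℤP.+-assoc x _ _))

sumℤ-cong : ∀ {A : Set} (xs : List A) {f g : A → ℤ} → (∀ x → f x ≡ g x) → sumℤ (map f xs) ≡ sumℤ (map g xs)
sumℤ-cong xs eq = cong sumℤ (LP.map-cong eq xs)

sumℤ-cong-All : ∀ {A : Set} {ℓ} {Q : Pred A ℓ} {f g : A → ℤ} {xs} →
  All Q xs → (∀ x → Q x → f x ≡ g x) → sumℤ (map f xs) ≡ sumℤ (map g xs)
sumℤ-cong-All []        eq = refl
sumℤ-cong-All (qx ∷ qs) eq = cong₂ _+_ (eq _ qx) (sumℤ-cong-All qs eq)

sumℤ-applyUpTo : ∀ {A : Set} n (g : ℕ → A) (f : A → ℤ) → sumℤ (map f (applyUpTo g n)) ≡ Σ< n (f ∘ g)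
sumℤ-applyUpTo zero    g f = refl
sumℤ-applyUpTo (suc n) g f = +-congˡ (f (g 0)) (sumℤ-applyUpTo n (g ∘ suc) f)

sumℤ-filter : ∀ {A : Set} {p} {P : Pred A p} (P? : Decidable P) (f : A → ℤ) xs →
  sumℤ (map f (filter P? xs)) ≡ sumℤ (map (λ x → 𝟙 (P? x) * f x) xs)
sumℤ-filter P? f [] = refl
sumℤ-filter P? f (x ∷ xs) with P? x
... | yes _ = cong₂ _+_ (sym (ℤP.*-identityˡ (f x))) (sumℤ-filter P? f xs)
... | no _  = trans (sumℤ-filter P? f xs)
                (sym (trans (+-congʳ (sumℤ (map (λ x → 𝟙 (P? x) * f x) xs)) (ℤP.*-zeroˡ (f x))) (ℤP.+-identityˡ _)))

filter-All : ∀ {A : Set} {ℓ} {P : Pred A ℓ} (P? : Decidable P) xs → All P (filter P? xs)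
filter-All P? [] = []
filter-All P? (x ∷ xs) with P? x
... | yes px = px ∷ filter-All P? xs
... | no _   = filter-All P? xs

filter-All-pair : ∀ {A : Set} {ℓ ℓ'} {P : Pred A ℓ} {Q : Pred A ℓ'} (P? : Decidable P) {xs} →
  All Q xs → All (λ x → Q x × P x) (filter P? xs)
filter-All-pair P? []        = []
filter-All-pair P? {x ∷ xs} (qx ∷ qs) with P? x
... | yes px = (qx , px) ∷ filter-All-pair P? qs
... | no _   = filter-All-pair P? qs

ev : Poly → (ℕ → ℤ) → ℤ
ev []      h = 0ℤ
ev (a ∷ p) h = a * h 0 + ev p (λ t → h (suc t))

ev-Σ : ∀ p (h : ℕ → ℤ) → ev p h ≡ Σ< (length p) (λ t → coeff p t * h t)
ev-Σ []      h = refl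
ev-Σ (a ∷ p) h = +-congˡ (a * h 0) (ev-Σ p (λ t → h (suc t)))

ev-cong : ∀ p {h h'} → (∀ t → h t ≡ h' t) → ev p h ≡ ev p h'
ev-cong []      eq = refl
ev-cong (a ∷ p) eq = cong₂ _+_ (cong (a *_) (eq 0)) (ev-cong p (λ t → eq (suc t)))

ev-+ₚ : ∀ p q h → ev (p +ₚ q) h ≡ ev p h + ev q h
ev-+ₚ []      q       h = sym (ℤP.+-identityˡ _)
ev-+ₚ (a ∷ p) []      h = sym (ℤP.+-identityʳ _)
ev-+ₚ (a ∷ p) (b ∷ q) h =
  trans (cong₂ _+_ (ℤP.*-distribʳ-+ (h 0) a b) (ev-+ₚ p q _)) (interchange (a * h 0) (b * h 0) _ _)

ev-monomial : ∀ k h → ev (monomial k) h ≡ h k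
ev-monomial zero    h = trans (+-congʳ 0ℤ (ℤP.*-identityˡ (h 0))) (ℤP.+-identityʳ (h 0))
ev-monomial (suc k) h = trans (+-congʳ (ev (monomial k) (λ t → h (suc t))) (ℤP.*-zeroˡ (h 0)))
                          (trans (ℤP.+-identityˡ _) (ev-monomial k (λ t → h (suc t))))

ev-+ : ∀ p (h h' : ℕ → ℤ) → ev p (λ t → h t + h' t) ≡ ev p h + ev p h'
ev-+ p h h' = trans (ev-Σ p _)
  (trans (Σ-cong (length p) (λ t → ℤP.*-distribˡ-+ (coeff p t) (h t) (h' t)))
  (trans (Σ-+ (length p) _ _) (sym (cong₂ _+_ (ev-Σ p h) (ev-Σ p h')))))

ev-* : ∀ p a (h : ℕ → ℤ) → ev p (λ t → a * h t) ≡ a * ev p h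
ev-* p a h = trans (ev-Σ p _)
  (trans (Σ-cong (length p) (λ t → lemma (coeff p t) a (h t)))
  (trans (Σ-* (length p) a _) (cong (a *_) (sym (ev-Σ p h)))))
  where
  lemma : ∀ x y z → x * (y * z) ≡ y * (x * z)
  lemma = solve-∀

ev-Σ< : ∀ p n (F : ℕ → ℕ → ℤ) → ev p (λ t → Σ< n (λ s → F s t)) ≡ Σ< n (λ s → ev p (F s))
ev-Σ< p n F = trans (ev-Σ p _)
  (trans (Σ-cong (length p) (λ t → sym (Σ-* n (coeff p t) (λ s → F s t))))
  (trans (Σ-swap (length p) n _) (Σ-cong n (λ s → sym (ev-Σ p (F s))))))

ev-sumℤ : ∀ {A : Set} p (xs : List A) (F : A → ℕ → ℤ) →
  ev p (λ t → sumℤ (map (λ x → F x t) xs)) ≡ sumℤ (map (λ x → ev p (F x)) xs)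
ev-sumℤ p []       F = trans (ev-Σ p _) (Σ-zero (length p) (λ t → ℤP.*-zeroʳ (coeff p t)))
ev-sumℤ p (x ∷ xs) F = trans (ev-+ p (F x) _) (+-congˡ (ev p (F x)) (ev-sumℤ p xs F))

𝐒-ev : ∀ d s f → 𝐒 d s f ≡ ev f (λ t → 𝟙 (d ∣? ℤ.∣ + t - s ∣))
𝐒-ev d s f = trans (sumℤ-filter _ (coeff f) (upTo (length f)))
  (trans (sumℤ-applyUpTo (length f) (λ x → x) _)
  (trans (Σ-cong (length f) (λ t → ℤP.*-comm _ (coeff f t))) (sym (ev-Σ f _))))

-- Σ⊆ j g i = Σ_{S ⊆ {1,…,j}} g (i - ΣS), computed by deciding whether j ∈ S.
Σ⊆ : ℕ → (ℤ → ℤ) → ℤ → ℤ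
Σ⊆ zero    g i = g i
Σ⊆ (suc j) g i = Σ⊆ j g i + Σ⊆ j g (i - + suc j)

ev-N : ∀ j g i → ev (N j) (λ t → g (i - + t)) ≡ Σ⊆ j g i
ev-N j g i = trans (ev-sums (subsets j)) (by-subsets j i)
  where
  ev-sums : ∀ Ss → ev (foldr _+ₚ_ [] (map (λ S → monomial (sumℕ S)) Ss)) (λ t → g (i - + t))
                   ≡ sumℤ (map (λ S → g (i - + sumℕ S)) Ss)
  ev-sums []       = refl
  ev-sums (S ∷ Ss) = trans (ev-+ₚ (monomial (sumℕ S)) _ _)
                       (cong₂ _+_ (ev-monomial (sumℕ S) (λ t → g (i - + t))) (ev-sums Ss))
  split : ∀ a b c → a - (b + c) ≡ (a - b) - c
  split = solve-∀
  by-subsets : ∀ j i → sumℤ (map (λ S → g (i - + sumℕ S)) (subsets j)) ≡ Σ⊆ j g i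
  by-subsets zero    i = trans (ℤP.+-identityʳ _) (cong g (ℤP.+-identityʳ i))
  by-subsets (suc j) i =
    trans (cong sumℤ (LP.map-++ _ (subsets j) _))
    (trans (sumℤ-++ (map _ (subsets j)) _)
    (cong₂ _+_ (by-subsets j i)
      (trans (cong sumℤ (sym (LP.map-∘ (subsets j))))
      (trans (sumℤ-cong (subsets j)
               (λ S → cong g (trans (cong (λ z → i - z) (ℤP.pos-+ (suc j) (sumℕ S))) (split i (+ suc j) (+ sumℕ S)))))
             (by-subsets j (i - + suc j))))))

Periodic : ℕ → (ℤ → ℤ) → Set
Periodic d g = ∀ x → g (x - + d) ≡ g x

periodic-multiple : ∀ {d} {g : ℤ → ℤ} → Periodic d g → ∀ k → Periodic (k ℕ.* d) g
periodic-multiple {d} {g} per zero    x = cong g (ℤP.+-identityʳ x)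
periodic-multiple {d} {g} per (suc k) x =
  trans (cong g (trans (cong (λ z → x - z) (ℤP.pos-+ d (k ℕ.* d))) (regroup x (+ d) (+ (k ℕ.* d)))))
        (trans (per _) (periodic-multiple per k x))
  where
  regroup : ∀ a b e → a - (b + e) ≡ a - e - b
  regroup = solve-∀

Σ⊆-cong : ∀ j {g g' : ℤ → ℤ} → (∀ x → g x ≡ g' x) → ∀ i → Σ⊆ j g i ≡ Σ⊆ j g' i
Σ⊆-cong zero    eq i = eq i
Σ⊆-cong (suc j) eq i = cong₂ _+_ (Σ⊆-cong j eq i) (Σ⊆-cong j eq _)

Σ⊆-+ : ∀ j (g₁ g₂ : ℤ → ℤ) i → Σ⊆ j (λ x → g₁ x + g₂ x) i ≡ Σ⊆ j g₁ i + Σ⊆ j g₂ i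
Σ⊆-+ zero    g₁ g₂ i = refl
Σ⊆-+ (suc j) g₁ g₂ i =
  trans (cong₂ _+_ (Σ⊆-+ j g₁ g₂ i) (Σ⊆-+ j g₁ g₂ _)) (interchange (Σ⊆ j g₁ i) (Σ⊆ j g₂ i) _ _)

Σ⊆-zero : ∀ j {g : ℤ → ℤ} → (∀ x → g x ≡ 0ℤ) → ∀ i → Σ⊆ j g i ≡ 0ℤ
Σ⊆-zero zero    z i = z i
Σ⊆-zero (suc j) z i = cong₂ _+_ (Σ⊆-zero j z i) (Σ⊆-zero j z _)

Σ⊆-translate : ∀ j (g : ℤ → ℤ) k i → Σ⊆ j (λ x → g (x - k)) i ≡ Σ⊆ j g (i - k)
Σ⊆-translate zero    g k i = refl
Σ⊆-translate (suc j) g k i =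
  cong₂ _+_ (Σ⊆-translate j g k i) (trans (Σ⊆-translate j g k _) (cong (Σ⊆ j g) (swap i k (+ suc j))))
  where
  swap : ∀ a b c → a - c - b ≡ a - b - c
  swap = solve-∀

Σ⊆-periodic : ∀ j {d} {g : ℤ → ℤ} → Periodic d g → Periodic d (Σ⊆ j g)
Σ⊆-periodic j {d} {g} per x = trans (sym (Σ⊆-translate j g (+ d) x)) (Σ⊆-cong j per x)

-- If g is antiperiodic with antiperiod k + 1 ≤ j, then every Σ⊆ j g vanishes:
-- already the subsets of {1,…,k+1} pair off according to whether k + 1 ∈ S.
Σ⊆-antiperiodic : ∀ (g : ℤ → ℤ) k → (∀ x → g x + g (x - + suc k) ≡ 0ℤ) →
  ∀ j → k < j → ∀ i → Σ⊆ j g i ≡ 0ℤ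
Σ⊆-antiperiodic g k anti (suc j) (s≤s k≤j) i with ℕP.m≤n⇒m<n∨m≡n k≤j
... | inj₂ refl = trans (+-congˡ (Σ⊆ k g i) (sym (Σ⊆-translate k g (+ suc k) i)))
                    (trans (sym (Σ⊆-+ k g (λ x → g (x - + suc k)) i)) (Σ⊆-zero k anti i))
... | inj₁ k<j  = cong₂ _+_ (Σ⊆-antiperiodic g k anti j k<j i) (Σ⊆-antiperiodic g k anti j k<j _)

-- Σ⊆from a b h i = Σ_{S ⊆ {a+1,…,a+b}} h (i - ΣS).
Σ⊆from : ℕ → ℕ → (ℤ → ℤ) → ℤ → ℤ
Σ⊆from a zero    h i = h i
Σ⊆from a (suc b) h i = Σ⊆from a b h i + Σ⊆from a b h (i - + (a ℕ.+ suc b))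

-- A subset of {1,…,a+b} splits into its parts in {1,…,a} and {a+1,…,a+b}.
Σ⊆-split : ∀ a b g i → Σ⊆ (a ℕ.+ b) g i ≡ Σ⊆from a b (Σ⊆ a g) i
Σ⊆-split a zero    g i rewrite ℕP.+-identityʳ a = refl
Σ⊆-split a (suc b) g i rewrite ℕP.+-suc a b = cong₂ _+_ (Σ⊆-split a b g i) (Σ⊆-split a b g _)

Σ⊆from-cong : ∀ a b {h h' : ℤ → ℤ} → (∀ x → h x ≡ h' x) → ∀ i → Σ⊆from a b h i ≡ Σ⊆from a b h' i
Σ⊆from-cong a zero    eq i = eq i
Σ⊆from-cong a (suc b) eq i = cong₂ _+_ (Σ⊆from-cong a b eq i) (Σ⊆from-cong a b eq _)

Σ⊆from-* : ∀ a b c (h : ℤ → ℤ) i → Σ⊆from a b (λ x → c * h x) i ≡ c * Σ⊆from a b h i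
Σ⊆from-* a zero    c h i = refl
Σ⊆from-* a (suc b) c h i =
  trans (cong₂ _+_ (Σ⊆from-* a b c h i) (Σ⊆from-* a b c h _)) (sym (ℤP.*-distribˡ-+ c _ _))

-- For d-periodic h the elements d + k and k act alike.
Σ⊆from-periodic : ∀ d m {h : ℤ → ℤ} → Periodic d h → ∀ i → Σ⊆from d m h i ≡ Σ⊆ m h i
Σ⊆from-periodic d zero    per i = refl
Σ⊆from-periodic d (suc m) {h} per i = cong₂ _+_ (Σ⊆from-periodic d m per i)
  (trans (Σ⊆from-periodic d m per _)
  (trans (cong (Σ⊆ m h) (trans (cong (λ z → i - z) (ℤP.pos-+ d (suc m))) (regroup i (+ d) (+ suc m))))
         (Σ⊆-periodic m per (i - + suc m))))
  where
  regroup : ∀ a b c → a - (b + c) ≡ a - c - b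
  regroup = solve-∀

-- If g is d-periodic and Σ⊆ d g = 2g, each full block {kd+1,…,(k+1)d} doubles
-- the sum: Σ⊆ (qd + r) g = 2^q Σ⊆ r g.
Σ⊆-doubling : ∀ d {g : ℤ → ℤ} → Periodic d g → (∀ x → Σ⊆ d g x ≡ + 2 * g x) →
  ∀ q r i → Σ⊆ (q ℕ.* d ℕ.+ r) g i ≡ (+ 2) ^ q * Σ⊆ r g i
Σ⊆-doubling d per double zero    r i = sym (ℤP.*-identityˡ _)
Σ⊆-doubling d {g} per double (suc q) r i rewrite ℕP.+-assoc d (q ℕ.* d) r = begin
  Σ⊆ (d ℕ.+ m) g i                   ≡⟨ Σ⊆-split d m g i ⟩
  Σ⊆from d m (Σ⊆ d g) i              ≡⟨ Σ⊆from-cong d m double i ⟩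
  Σ⊆from d m (λ x → + 2 * g x) i     ≡⟨ Σ⊆from-* d m (+ 2) g i ⟩
  + 2 * Σ⊆from d m g i               ≡⟨ cong (+ 2 *_) (Σ⊆from-periodic d m per i) ⟩
  + 2 * Σ⊆ m g i                     ≡⟨ cong (+ 2 *_) (Σ⊆-doubling d per double q r i) ⟩
  + 2 * ((+ 2) ^ q * Σ⊆ r g i)       ≡⟨ sym (ℤP.*-assoc (+ 2) ((+ 2) ^ q) _) ⟩
  (+ 2) ^ suc q * Σ⊆ r g i           ∎
  where
  open ≡-Reasoning
  m = q ℕ.* d ℕ.+ r

-- A graded function h i s; the grade s records the size of a subset.
Graded : Set
Graded = ℤ → ℕ → ℤ

_≈_ : Graded → Graded → Set
h ≈ h' = ∀ i s → h i s ≡ h' i s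

≈-trans : ∀ {h₁ h₂ h₃} → h₁ ≈ h₂ → h₂ ≈ h₃ → h₁ ≈ h₃
≈-trans e₁ e₂ i s = trans (e₁ i s) (e₂ i s)

-- Adjoining the element k: either k is left out, or it is taken, which
-- translates by k and raises the size by one.
adjoin : ℕ → Graded → Graded
adjoin k h i zero    = h i zero
adjoin k h i (suc s) = h i (suc s) + h (i - + k) s

-- Σ⊆ᵍ j h adjoins 1, …, j; for h concentrated in grade 0 (see below),
-- Σ⊆ᵍ j h i s = Σ_{S ⊆ {1,…,j}, |S| = s} h (i - ΣS) 0.
Σ⊆ᵍ : ℕ → Graded → Graded
Σ⊆ᵍ zero    h = h
Σ⊆ᵍ (suc j) h = adjoin (suc j) (Σ⊆ᵍ j h)

Σ⊆ᵍ⁺ : ℕ → Graded → Graded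
Σ⊆ᵍ⁺ zero    h = h
Σ⊆ᵍ⁺ (suc j) h = adjoin (suc (suc j)) (Σ⊆ᵍ⁺ j h)

-- Moving the sum by the size: adding 1 to every element of S adds |S| to ΣS.
twist : Graded → Graded
twist h i s = h (i + + s) s

adjoin-cong : ∀ k {h h'} → h ≈ h' → adjoin k h ≈ adjoin k h'
adjoin-cong k e i zero    = e i zero
adjoin-cong k e i (suc s) = cong₂ _+_ (e i (suc s)) (e _ s)

adjoin-comm : ∀ a b h → adjoin a (adjoin b h) ≈ adjoin b (adjoin a h)
adjoin-comm a b h i zero          = refl
adjoin-comm a b h i (suc zero)    = swap₃ (h i 1) (h (i - + b) 0) (h (i - + a) 0)
  where
  swap₃ : ∀ x y z → (x + y) + z ≡ (x + z) + y
  swap₃ = solve-∀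
adjoin-comm a b h i (suc (suc s)) =
  trans (cong (λ z → (h i (suc (suc s)) + h (i - + b) (suc s)) + (h (i - + a) (suc s) + h z s)) (swap i (+ a) (+ b)))
        (interchange (h i (suc (suc s))) (h (i - + b) (suc s)) (h (i - + a) (suc s)) (h (i - + b - + a) s))
  where
  swap : ∀ x y z → x - y - z ≡ x - z - y
  swap = solve-∀

Σ⊆ᵍ-cong : ∀ j {h h'} → h ≈ h' → Σ⊆ᵍ j h ≈ Σ⊆ᵍ j h'
Σ⊆ᵍ-cong zero    e = e
Σ⊆ᵍ-cong (suc j) e = adjoin-cong (suc j) (Σ⊆ᵍ-cong j e)

Σ⊆ᵍ⁺-cong : ∀ j {h h'} → h ≈ h' → Σ⊆ᵍ⁺ j h ≈ Σ⊆ᵍ⁺ j h'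
Σ⊆ᵍ⁺-cong zero    e = e
Σ⊆ᵍ⁺-cong (suc j) e = adjoin-cong (suc (suc j)) (Σ⊆ᵍ⁺-cong j e)

Σ⊆ᵍ⁺-adjoin : ∀ j a h → adjoin a (Σ⊆ᵍ⁺ j h) ≈ Σ⊆ᵍ⁺ j (adjoin a h)
Σ⊆ᵍ⁺-adjoin zero    a h i s = refl
Σ⊆ᵍ⁺-adjoin (suc j) a h =
  ≈-trans (adjoin-comm a (suc (suc j)) (Σ⊆ᵍ⁺ j h)) (adjoin-cong (suc (suc j)) (Σ⊆ᵍ⁺-adjoin j a h))

Σ⊆ᵍ⁺-adjoin-1 : ∀ j h → Σ⊆ᵍ⁺ j (adjoin 1 h) ≈ Σ⊆ᵍ (suc j) h
Σ⊆ᵍ⁺-adjoin-1 zero    h i s = refl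
Σ⊆ᵍ⁺-adjoin-1 (suc j) h = adjoin-cong (suc (suc j)) (Σ⊆ᵍ⁺-adjoin-1 j h)

twist-adjoin : ∀ k h → twist (adjoin (suc k) h) ≈ adjoin k (twist h)
twist-adjoin k h i zero    = refl
twist-adjoin k h i (suc s) = cong (λ z → h (i + + suc s) (suc s) + h z s) (shift i (+ k) (+ s))
  where
  shift : ∀ x y z → x + (1ℤ + z) - (1ℤ + y) ≡ x - y + z
  shift = solve-∀

twist-Σ⊆ᵍ⁺ : ∀ j h → twist (Σ⊆ᵍ⁺ j h) ≈ Σ⊆ᵍ j (twist h)
twist-Σ⊆ᵍ⁺ zero    h i s = refl
twist-Σ⊆ᵍ⁺ (suc j) h = ≈-trans (twist-adjoin (suc j) (Σ⊆ᵍ⁺ j h)) (adjoin-cong (suc j) (twist-Σ⊆ᵍ⁺ j h))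

Periodicᵍ : ℕ → Graded → Set
Periodicᵍ d h = ∀ s → Periodic d (λ i → h i s)

adjoin-periodic : ∀ d h → Periodicᵍ d h → adjoin (suc d) h ≈ adjoin 1 h
adjoin-periodic d h per i zero    = refl
adjoin-periodic d h per i (suc s) = +-congˡ (h i (suc s))
  (trans (cong (λ z → h z s) (trans (cong (λ z → i - z) (ℤP.pos-+ 1 d)) (regroup i (+ d)))) (per s (i - 1ℤ)))
  where
  regroup : ∀ x y → x - (1ℤ + y) ≡ x - 1ℤ - y
  regroup = solve-∀

adjoin-Periodicᵍ : ∀ d k h → Periodicᵍ d h → Periodicᵍ d (adjoin k h)
adjoin-Periodicᵍ d k h per zero    i = per zero i
adjoin-Periodicᵍ d k h per (suc s) i =
  cong₂ _+_ (per (suc s) i) (trans (cong (λ z → h z s) (swap i (+ d) (+ k))) (per s (i - + k)))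
  where
  swap : ∀ x y z → x - y - z ≡ x - z - y
  swap = solve-∀

Σ⊆ᵍ-Periodicᵍ : ∀ d j h → Periodicᵍ d h → Periodicᵍ d (Σ⊆ᵍ j h)
Σ⊆ᵍ-Periodicᵍ d zero    h per = per
Σ⊆ᵍ-Periodicᵍ d (suc j) h per = adjoin-Periodicᵍ d (suc j) (Σ⊆ᵍ j h) (Σ⊆ᵍ-Periodicᵍ d j h per)

Balanced : ℕ → ℕ → (ℤ → ℤ) → Set
Balanced p w g = ∀ i → Σ< p (λ m → g (i - + (m ℕ.* w))) ≡ 0ℤ

Balancedᵍ : ℕ → ℕ → Graded → Set
Balancedᵍ p w h = ∀ s → Balanced p w (λ i → h i s)

adjoin-Balancedᵍ : ∀ p w k h → Balancedᵍ p w h → Balancedᵍ p w (adjoin k h)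
adjoin-Balancedᵍ p w k h bal zero    i = bal zero i
adjoin-Balancedᵍ p w k h bal (suc s) i =
  trans (Σ-+ p _ _) (trans (cong₂ _+_ (bal (suc s) i)
    (trans (Σ-cong p (λ m → cong (λ z → h z s) (swap i (+ k) (+ (m ℕ.* w))))) (bal s (i - + k)))) refl)
  where
  swap : ∀ x y z → x - z - y ≡ x - y - z
  swap = solve-∀

Σ⊆ᵍ-Balancedᵍ : ∀ p w j h → Balancedᵍ p w h → Balancedᵍ p w (Σ⊆ᵍ j h)
Σ⊆ᵍ-Balancedᵍ p w zero    h bal = bal
Σ⊆ᵍ-Balancedᵍ p w (suc j) h bal = adjoin-Balancedᵍ p w (suc j) (Σ⊆ᵍ j h) (Σ⊆ᵍ-Balancedᵍ p w j h bal)

concentrated : (ℤ → ℤ) → Graded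
concentrated g i zero    = g i
concentrated g i (suc s) = 0ℤ

twist-concentrated : ∀ g → twist (concentrated g) ≈ concentrated g
twist-concentrated g i zero    = cong g (ℤP.+-identityʳ i)
twist-concentrated g i (suc s) = refl

concentrated-Periodicᵍ : ∀ {d} {g} → Periodic d g → Periodicᵍ d (concentrated g)
concentrated-Periodicᵍ per zero    = per
concentrated-Periodicᵍ per (suc s) i = refl

concentrated-Balancedᵍ : ∀ p w {g} → Balanced p w g → Balancedᵍ p w (concentrated g)
concentrated-Balancedᵍ p w bal zero    = bal
concentrated-Balancedᵍ p w bal (suc s) i = Σ-zero p (λ _ → refl)

-- Rotation invariance: for d-periodic g, the map S ↦ S + 1 (mod d) permutes the
-- s-subsets of {1,…,d} and raises ΣS by s, so grade s of Σ⊆ᵍ d is s-periodic.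
Σ⊆ᵍ-rotation : ∀ d' {g} → Periodic (suc d') g → ∀ s i →
  Σ⊆ᵍ (suc d') (concentrated g) (i + + s) s ≡ Σ⊆ᵍ (suc d') (concentrated g) i s
Σ⊆ᵍ-rotation d' {g} per s i =
  trans (sym (shifted (i + + s) s))
        (trans (twist-Σ⊆ᵍ⁺ (suc d') (concentrated g) i s) (Σ⊆ᵍ-cong (suc d') (twist-concentrated g) i s))
  where
  shifted : Σ⊆ᵍ⁺ (suc d') (concentrated g) ≈ Σ⊆ᵍ (suc d') (concentrated g)
  shifted = ≈-trans (Σ⊆ᵍ⁺-adjoin d' (suc (suc d')) (concentrated g))
              (≈-trans (Σ⊆ᵍ⁺-cong d' (adjoin-periodic (suc d') (concentrated g) (concentrated-Periodicᵍ per)))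
                       (Σ⊆ᵍ⁺-adjoin-1 d' (concentrated g)))

-- No subset of {1,…,j} has more than j elements.
Σ⊆ᵍ-beyond : ∀ g j i s → j < s → Σ⊆ᵍ j (concentrated g) i s ≡ 0ℤ
Σ⊆ᵍ-beyond g zero    i (suc s) _ = refl
Σ⊆ᵍ-beyond g (suc j) i (suc s) (s≤s j<s) =
  cong₂ _+_ (Σ⊆ᵍ-beyond g j i (suc s) (ℕP.m<n⇒m<1+n j<s)) (Σ⊆ᵍ-beyond g j _ s j<s)

-- Only the empty set has size 0.
Σ⊆ᵍ-grade0 : ∀ j h i → Σ⊆ᵍ j h i zero ≡ h i zero
Σ⊆ᵍ-grade0 zero    h i = refl
Σ⊆ᵍ-grade0 (suc j) h i = Σ⊆ᵍ-grade0 j h i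

triangle : ℕ → ℕ
triangle zero    = zero
triangle (suc j) = suc j ℕ.+ triangle j

-- Only {1,…,j} has size j, and its sum is the triangular number.
Σ⊆ᵍ-top : ∀ g j i → Σ⊆ᵍ j (concentrated g) i j ≡ g (i - + triangle j)
Σ⊆ᵍ-top g zero    i = cong g (sym (ℤP.+-identityʳ i))
Σ⊆ᵍ-top g (suc j) i =
  trans (cong₂ _+_ (Σ⊆ᵍ-beyond g j i (suc j) ℕP.≤-refl) (Σ⊆ᵍ-top g j (i - + suc j)))
  (trans (ℤP.+-identityˡ _)
         (cong g (trans (regroup i (+ suc j) (+ triangle j)) (cong (λ z → i - z) (sym (ℤP.pos-+ (suc j) (triangle j)))))))
  where
  regroup : ∀ x y z → x - y - z ≡ x - (y + z)
  regroup = solve-∀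

Σ⊆ᵍ-total : ∀ g j i → Σ< (suc j) (Σ⊆ᵍ j (concentrated g) i) ≡ Σ⊆ j g i
Σ⊆ᵍ-total g zero    i = ℤP.+-identityʳ (g i)
Σ⊆ᵍ-total g (suc j) i =
  trans (+-congˡ (G j i 0) (Σ-+ (suc j) (λ s → G j i (suc s)) (G j (i - + suc j))))
  (trans (sym (ℤP.+-assoc (G j i 0) _ _))
  (cong₂ _+_ (trans (Σ-last (suc j) (G j i))
               (trans (+-congˡ (Σ< (suc j) (G j i)) (Σ⊆ᵍ-beyond g j i (suc j) ℕP.≤-refl))
               (trans (ℤP.+-identityʳ _) (Σ⊆ᵍ-total g j i))))
             (Σ⊆ᵍ-total g j (i - + suc j))))
  where
  G : ℕ → ℤ → ℕ → ℤ
  G j = Σ⊆ᵍ j (concentrated g)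

periodic-combination : ∀ {a b H} → Periodic a H → Periodic b H →
  ∀ x y c → c ℕ.+ y ℕ.* b ≡ x ℕ.* a → Periodic c H
periodic-combination {a} {b} {H} per-a per-b x y c eq i =
  trans (sym (periodic-multiple per-b y (i - + c)))
  (trans (cong H (trans (regroup i (+ c) (+ (y ℕ.* b))) (cong (λ z → i - z) (trans (sym (ℤP.pos-+ c _)) (cong +_ eq)))))
         (periodic-multiple per-a x i))
  where
  regroup : ∀ u v w → u - v - w ≡ u - (v + w)
  regroup = solve-∀

periodic-gcd : ∀ {s d H} → Periodic s H → Periodic d H → Periodic (gcd s d) H
periodic-gcd {s} {d} per-s per-d with Bézout.identity (gcd-GCD s d)
... | Bézout.+- x y eq = periodic-combination per-s per-d x y _ eq
... | Bézout.-+ x y eq = periodic-combination per-d per-s y x _ eq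

gcd-cofactor≥2 : ∀ s d → 0 < s → s < d → 2 ≤ ND.quotient (gcd[m,n]∣n s d)
gcd-cofactor≥2 s d 0<s s<d with ND.quotient (gcd[m,n]∣n s d) | ND._∣_.equality (gcd[m,n]∣n s d)
... | zero        | d≡0 = ⊥-elim (ℕP.<⇒≢ (ℕP.<-trans 0<s s<d) (sym d≡0))
... | suc zero    | d≡g = ⊥-elim (ℕP.<⇒≱ s<d (subst (_≤ s) (sym (trans d≡g (ℕP.+-identityʳ _))) g≤s))
  where
  g≤s : gcd s d ≤ s
  g≤s = ND.∣⇒≤ {{ℕ.>-nonZero 0<s}} (gcd[m,n]∣m s d)
... | suc (suc _) | _   = s≤s (s≤s z≤n)

prime-step : ∀ s d → 0 < s → s < d → Σ ℕ (λ p → Σ ℕ (λ w → Prime p × d ≡ p ℕ.* w × gcd s d ∣ w))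
prime-step s d 0<s s<d with prime-factor _ (gcd-cofactor≥2 s d 0<s s<d)
... | p , pp , divides u t≡up =
  p , u ℕ.* gcd s d , pp ,
  trans (ND._∣_.equality (gcd[m,n]∣n s d)) (trans (cong (ℕ._* gcd s d) t≡up) (reassoc u p (gcd s d))) ,
  ND.n∣m*n u
  where
  reassoc : ∀ a b c → a ℕ.* b ℕ.* c ≡ b ℕ.* (a ℕ.* c)
  reassoc = solveℕ-∀

-- A function H with periods s and d (0 < s < d) that is balanced for every
-- factorisation d = p w with p prime vanishes: H has period g = gcd(s, d) < d,
-- and for a prime p ∣ d / g the progression of step w = d / p moves by
-- multiples of g, so p · H i = Σ_{m<p} H (i - m w) = 0.
balanced-vanish : ∀ {H : ℤ → ℤ} d s → 0 < s → s < d → Periodic s H → Periodic d H →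
  (∀ p w → Prime p → d ≡ p ℕ.* w → Balanced p w H) → ∀ i → H i ≡ 0ℤ
balanced-vanish {H} d s 0<s s<d per-s per-d bal i with prime-step s d 0<s s<d
... | p , w , pp , d≡pw , divides u w≡ug = prime-cancel pp (H i) (begin
  + p * H i                         ≡⟨ Σ-const p (H i) ⟨
  Σ< p (λ _ → H i)                  ≡⟨ Σ-cong p constant ⟨
  Σ< p (λ m → H (i - + (m ℕ.* w)))  ≡⟨ bal p w pp d≡pw i ⟩
  0ℤ                                ∎)
  where
  open ≡-Reasoning
  constant : ∀ m → H (i - + (m ℕ.* w)) ≡ H i
  constant m = trans (cong (λ z → H (i - + z)) (trans (cong (m ℕ.*_) w≡ug) (sym (ℕP.*-assoc m u _))))
                     (periodic-multiple (periodic-gcd per-s per-d) (m ℕ.* u) i)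

triangle-odd : ∀ a → triangle (suc (a ℕ.* 2)) ≡ suc a ℕ.* suc (a ℕ.* 2)
triangle-odd a = ℕP.*-cancelˡ-≡ _ _ 2 (trans (double (suc (a ℕ.* 2))) (expand a))
  where
  double : ∀ j → 2 ℕ.* triangle j ≡ j ℕ.* suc j
  double zero    = refl
  double (suc j) = trans (ℕP.*-distribˡ-+ 2 (suc j) (triangle j)) (trans (cong (2 ℕ.* suc j ℕ.+_) (double j)) (step j))
    where
    step : ∀ j → 2 ℕ.* suc j ℕ.+ j ℕ.* suc j ≡ suc j ℕ.* suc (suc j)
    step = solveℕ-∀
  expand : ∀ a → suc (a ℕ.* 2) ℕ.* suc (suc (a ℕ.* 2)) ≡ 2 ℕ.* (suc a ℕ.* suc (a ℕ.* 2))
  expand = solveℕ-∀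

-- Grading by size, the empty set
-- and {1,…,d} (whose sum ≡ 0 mod d) each contribute g, and every
-- intermediate grade vanishes by rotation invariance and balanced-vanish.
Σ⊆-odd-period : ∀ a {g} → let d = suc (a ℕ.* 2) in Periodic d g →
  (∀ p w → Prime p → d ≡ p ℕ.* w → Balanced p w g) → ∀ i → Σ⊆ d g i ≡ + 2 * g i
Σ⊆-odd-period a {g} per bal i = begin
  Σ⊆ d g i                                      ≡⟨ Σ⊆ᵍ-total g d i ⟨
  Σ< (suc d) (G i)                              ≡⟨ +-congˡ (G i 0) (Σ-last (a ℕ.* 2) (λ s → G i (suc s))) ⟩
  G i 0 + (Σ< (a ℕ.* 2) (λ s → G i (suc s)) + G i d)
    ≡⟨ cong₂ _+_ (Σ⊆ᵍ-grade0 d (concentrated g) i) (cong₂ _+_ (Σ-zero< (a ℕ.* 2) intermediate) (Σ⊆ᵍ-top g d i)) ⟩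
  g i + (0ℤ + g (i - + triangle d))             ≡⟨ +-congˡ (g i) (trans (ℤP.+-identityˡ _) full) ⟩
  g i + g i                                     ≡⟨ twice (g i) ⟩
  + 2 * g i                                     ∎
  where
  open ≡-Reasoning
  d = suc (a ℕ.* 2)
  G : ℤ → ℕ → ℤ
  G = Σ⊆ᵍ d (concentrated g)
  twice : ∀ x → x + x ≡ + 2 * x
  twice = solve-∀
  full : g (i - + triangle d) ≡ g i
  full = trans (cong (λ z → g (i - + z)) (triangle-odd a)) (periodic-multiple per (suc a) i)
  rotation : ∀ s → Periodic s (λ x → G x s)
  rotation s x = trans (sym (Σ⊆ᵍ-rotation (a ℕ.* 2) per s (x - + s))) (cong (λ z → G z s) (cancel x (+ s)))
    where
    cancel : ∀ u v → u - v + v ≡ u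
    cancel = solve-∀
  intermediate : ∀ s → s < a ℕ.* 2 → G i (suc s) ≡ 0ℤ
  intermediate s s<2a = balanced-vanish d (suc s) (s≤s z≤n) (s≤s s<2a) (rotation (suc s))
    (Σ⊆ᵍ-Periodicᵍ d d (concentrated g) (concentrated-Periodicᵍ per) (suc s))
    (λ p w pp eq → Σ⊆ᵍ-Balancedᵍ p w d (concentrated g) (concentrated-Balancedᵍ p w (bal p w pp eq)) (suc s)) i

count-pos : ∀ {A : Set} {P : A → Set} (P? : Decidable P) n (f : ℕ → A) k →
  k < n → P (f k) → 0 < length (filter P? (applyUpTo f n))
count-pos P? (suc n) f zero    k<n       Pk with P? (f 0)
... | yes _ = s≤s z≤n
... | no ¬P = ⊥-elim (¬P Pk)
count-pos P? (suc n) f (suc k) (s≤s k<n) Pk with P? (f 0)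
... | yes _ = s≤s z≤n
... | no _  = count-pos P? n (f ∘ suc) k k<n Pk

count-witness : ∀ {A : Set} {P : A → Set} (P? : Decidable P) n (f : ℕ → A) →
  0 < length (filter P? (applyUpTo f n)) → Σ ℕ (λ k → k < n × P (f k))
count-witness P? (suc n) f pos with P? (f 0)
... | yes P0 = 0 , s≤s z≤n , P0
... | no _ with count-witness P? n (f ∘ suc) pos
...   | k , k<n , Pk = suc k , s≤s k<n , Pk

count-Σ : ∀ {A : Set} {P : A → Set} (P? : Decidable P) xs → + length (filter P? xs) ≡ sumℤ (map (λ x → 𝟙 (P? x)) xs)
count-Σ P? [] = refl
count-Σ P? (x ∷ xs) with P? x
... | yes _ = trans (ℤP.pos-+ 1 _) (+-congˡ 1ℤ (count-Σ P? xs))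
... | no _  = trans (count-Σ P? xs) (sym (ℤP.+-identityˡ _))

squareCount : ℕ → ℕ
squareCount n = length (filter (λ k → (k ℕ.* k) ∣? n) (map (λ k → suc (suc k)) (upTo n)))

primeCount : ℕ → ℕ
primeCount n = length (filter (λ p → prime? p ×-dec (p ∣? n)) (upTo (suc n)))

-- By definition μ n reduces to μ-by-counts (squareCount n) (primeCount n).
μ-by-counts : ℕ → ℕ → ℤ
μ-by-counts s c = if not (s ℕ.≡ᵇ 0) then + 0 else (- (+ 1)) ^ c

squares : ∀ n → map (λ k → suc (suc k)) (upTo n) ≡ applyUpTo (λ k → suc (suc k)) n
squares n = LP.map-upTo (λ k → suc (suc k)) n

squareCount-pos : ∀ n a → 1 ≤ n → 2 ≤ a → a ℕ.* a ∣ n → 0 < squareCount n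
squareCount-pos n (suc zero) _ (s≤s ()) _
squareCount-pos n (suc (suc a')) 1≤n _ aa∣n =
  subst (λ xs → 0 < length (filter (λ k → (k ℕ.* k) ∣? n) xs)) (sym (squares n))
        (count-pos (λ k → (k ℕ.* k) ∣? n) n (λ k → suc (suc k)) a' a'<n aa∣n)
  where
  a'<n : a' < n
  a'<n = ℕP.≤-trans (ℕP.n≤1+n (suc a'))
           (ℕP.≤-trans (ℕP.m≤m*n (suc (suc a')) (suc (suc a'))) (ND.∣⇒≤ {{ℕ.>-nonZero 1≤n}} aa∣n))

squareCount-witness : ∀ n → 0 < squareCount n → Σ ℕ (λ a → 2 ≤ a × a ℕ.* a ∣ n)
squareCount-witness n pos
  with count-witness (λ k → (k ℕ.* k) ∣? n) n (λ k → suc (suc k))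
         (subst (λ xs → 0 < length (filter (λ k → (k ℕ.* k) ∣? n) xs)) (squares n) pos)
... | k , _ , P = suc (suc k) , s≤s (s≤s z≤n) , P

μ-square : ∀ n a → 1 ≤ n → 2 ≤ a → a ℕ.* a ∣ n → μ n ≡ 0ℤ
μ-square n a 1≤n 2≤a aa∣n with squareCount n | squareCount-pos n a 1≤n 2≤a aa∣n
... | suc _ | _ = refl

square-transfer : ∀ p k a → Prime p → ¬ p ∣ k → a ℕ.* a ∣ p ℕ.* k → a ℕ.* a ∣ k
square-transfer p k a pp ¬p∣k aa∣pk with p ∣? a
... | yes (divides t refl) =
  ⊥-elim (¬p∣k (ND.*-cancelˡ-∣ p {{prime⇒nonZero pp}} (ND.∣-trans (divides (t ℕ.* t) (regroup t p)) aa∣pk)))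
  where
  regroup : ∀ t p → t ℕ.* p ℕ.* (t ℕ.* p) ≡ t ℕ.* t ℕ.* (p ℕ.* p)
  regroup = solveℕ-∀
... | no ¬p∣a = coprime-divisor (prime-coprime pp ¬p∣aa) aa∣pk
  where
  ¬p∣aa : ¬ p ∣ a ℕ.* a
  ¬p∣aa p∣aa with euclidsLemma a a pp p∣aa
  ... | inj₁ x = ¬p∣a x
  ... | inj₂ x = ¬p∣a x

primeCount-Σ : ∀ n → + primeCount n ≡ Σ< (suc n) (λ q → 𝟙 (prime? q ×-dec q ∣? n))
primeCount-Σ n = trans (count-Σ (λ q → prime? q ×-dec q ∣? n) (upTo (suc n)))
                       (sumℤ-applyUpTo (suc n) (λ x → x) (λ q → 𝟙 (prime? q ×-dec q ∣? n)))

prime-divisors-mul : ∀ p k q → Prime p → ¬ p ∣ k →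
  𝟙 (prime? q ×-dec q ∣? (p ℕ.* k)) ≡ 𝟙 (prime? q ×-dec q ∣? k) + 𝟙 (q ℕ.≟ p)
prime-divisors-mul p k q pp ¬p∣k with q ℕ.≟ p
... | yes refl = trans (𝟙-yes (pp , ND.m∣m*n k) (prime? q ×-dec q ∣? (p ℕ.* k)))
                       (sym (trans (ℤP.+-comm (𝟙 (prime? q ×-dec q ∣? k)) 1ℤ)
                                   (+-congˡ 1ℤ (𝟙-no (λ { (_ , q∣k) → ¬p∣k q∣k }) (prime? q ×-dec q ∣? k)))))
... | no q≢p = trans (𝟙-iff fwd bwd (prime? q ×-dec q ∣? (p ℕ.* k)) (prime? q ×-dec q ∣? k)) (sym (ℤP.+-identityʳ _))
  where
  fwd : Prime q × q ∣ p ℕ.* k → Prime q × q ∣ k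
  fwd (pq , q∣pk) with euclidsLemma p k pq q∣pk
  ... | inj₂ q∣k = pq , q∣k
  ... | inj₁ q∣p with prime⇒irreducible pp q∣p
  ...   | inj₁ refl = ⊥-elim (¬prime[1] pq)
  ...   | inj₂ q≡p  = ⊥-elim (q≢p q≡p)
  bwd : Prime q × q ∣ k → Prime q × q ∣ p ℕ.* k
  bwd (pq , q∣k) = pq , ND.∣-trans q∣k (ND.n∣m*n p)

primeCount-mul : ∀ p k → Prime p → 1 ≤ k → ¬ p ∣ k → primeCount (p ℕ.* k) ≡ suc (primeCount k)
primeCount-mul p k pp 1≤k ¬p∣k = ℤP.+-injective (begin
  + primeCount (p ℕ.* k)                          ≡⟨ primeCount-Σ (p ℕ.* k) ⟩
  Σ< B (λ q → 𝟙 (prime? q ×-dec q ∣? (p ℕ.* k)))  ≡⟨ Σ-cong B (λ q → prime-divisors-mul p k q pp ¬p∣k) ⟩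
  Σ< B (λ q → 𝟙 (prime? q ×-dec q ∣? k) + 𝟙 (q ℕ.≟ p))
    ≡⟨ Σ-+ B (λ q → 𝟙 (prime? q ×-dec q ∣? k)) (λ q → 𝟙 (q ℕ.≟ p)) ⟩
  Σ< B (λ q → 𝟙 (prime? q ×-dec q ∣? k)) + Σ< B (λ q → 𝟙 (q ℕ.≟ p))
    ≡⟨ cong₂ _+_ (trans (Σ-extend (suc k) B _ k<B beyond) (sym (primeCount-Σ k))) only-p ⟩
  + primeCount k + 1ℤ                            ≡⟨ ℤP.+-comm (+ primeCount k) 1ℤ ⟩
  + suc (primeCount k)                           ∎)
  where
  open ≡-Reasoning
  B = suc (p ℕ.* k)
  k<B : suc k ≤ B
  k<B = s≤s (ℕP.m≤n*m k p {{prime⇒nonZero pp}})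
  beyond : ∀ q → suc k ≤ q → 𝟙 (prime? q ×-dec q ∣? k) ≡ 0ℤ
  beyond q k<q = 𝟙-no (λ { (_ , q∣k) → ℕP.<⇒≱ k<q (ND.∣⇒≤ {{ℕ.>-nonZero 1≤k}} q∣k) }) (prime? q ×-dec q ∣? k)
  only-p : Σ< B (λ q → 𝟙 (q ℕ.≟ p)) ≡ 1ℤ
  only-p = trans (Σ-cong B (λ q → sym (ℤP.*-identityʳ (𝟙 (q ℕ.≟ p)))))
                 (Σ-delta B p (λ _ → 1ℤ) (s≤s (ℕP.m≤m*n p k {{ℕ.>-nonZero 1≤k}})))

μ-prime-mul : ∀ p k → Prime p → 1 ≤ k → ¬ p ∣ k → μ (p ℕ.* k) ≡ - μ k
μ-prime-mul p k pp 1≤k ¬p∣k with 0 ℕ.<? squareCount k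
... | yes pos with squareCount-witness k pos
...   | a , 2≤a , aa∣k =
  trans (μ-square (p ℕ.* k) a (ℕP.≤-trans 1≤k (ℕP.m≤n*m k p {{prime⇒nonZero pp}})) 2≤a (ND.∣-trans aa∣k (ND.n∣m*n p)))
        (sym (cong -_ (μ-square k a 1≤k 2≤a aa∣k)))
μ-prime-mul p k pp 1≤k ¬p∣k | no ¬pos =
  trans (cong₂ μ-by-counts squarefree-pk (primeCount-mul p k pp 1≤k ¬p∣k))
  (trans (ℤP.-1*i≡-i (μ-by-counts 0 (primeCount k))) (cong -_ (cong (λ s → μ-by-counts s (primeCount k)) (sym squarefree-k))))
  where
  squarefree-k : squareCount k ≡ 0
  squarefree-k = ℕP.n≤0⇒n≡0 (ℕP.≮⇒≥ ¬pos)
  squarefree-pk : squareCount (p ℕ.* k) ≡ 0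
  squarefree-pk with 0 ℕ.<? squareCount (p ℕ.* k)
  ... | no ¬pos' = ℕP.n≤0⇒n≡0 (ℕP.≮⇒≥ ¬pos')
  ... | yes pos' with squareCount-witness (p ℕ.* k) pos'
  ...   | a , 2≤a , aa∣pk = ⊥-elim (¬pos (squareCount-pos k a 1≤k 2≤a (square-transfer p k a pp ¬p∣k aa∣pk)))

-- DΣ B n f = Σ_{e ∣ n} f e, the range bound B > n being irrelevant.
DΣ : ℕ → ℕ → (ℕ → ℤ) → ℤ
DΣ B n f = Σ< B (λ e → 𝟙 (e ∣? n) * f e)

DΣ-extend : ∀ B B' n f → 1 ≤ n → n < B → B ≤ B' → DΣ B' n f ≡ DΣ B n f
DΣ-extend B B' n f 1≤n n<B B≤B' =
  Σ-extend B B' _ B≤B' (λ k B≤k → 𝟙-no-* (∤-large 1≤n (ℕP.<-≤-trans n<B B≤k)) (k ∣? n) (f k))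

divisors-DΣ : ∀ n (f : ℕ → ℤ) B → 1 ≤ n → n < B → sumℤ (map f (divisors n)) ≡ DΣ B n f
divisors-DΣ n f B 1≤n n<B =
  trans (sumℤ-filter (λ e → e ∣? n) f (map suc (upTo n)))
  (trans (cong (λ xs → sumℤ (map (λ x → 𝟙 (x ∣? n) * f x) xs)) (LP.map-upTo suc n))
  (trans (sumℤ-applyUpTo n suc (λ x → 𝟙 (x ∣? n) * f x))
  (trans (sym (trans (+-congʳ _ (𝟙-no-* (0∤ 1≤n) (0 ∣? n) (f 0))) (ℤP.+-identityˡ _)))
         (sym (DΣ-extend (suc n) B n f 1≤n ℕP.≤-refl n<B)))))

dilate : ∀ p B (f : ℕ → ℤ) → 1 ≤ p → Σ< (p ℕ.* B) (λ k → 𝟙 (p ∣? k) * f k) ≡ Σ< B (λ k → f (p ℕ.* k))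
dilate p zero    f 1≤p rewrite ℕP.*-zeroʳ p = refl
dilate p (suc B) f 1≤p rewrite ℕP.*-suc p B =
  trans (Σ-split p (p ℕ.* B) _) (cong₂ _+_ (trans first (cong f (sym (ℕP.*-zeroʳ p)))) rest)
  where
  first : Σ< p (λ k → 𝟙 (p ∣? k) * f k) ≡ f 0
  first = trans (Σ-cong< p (λ k k<p → cong (_* f k)
                   (𝟙-iff (small-multiple k<p) (λ eq → subst (p ∣_) (sym eq) (ND._∣0 p)) (p ∣? k) (k ℕ.≟ 0))))
                (Σ-delta p 0 f 1≤p)
  rest : Σ< (p ℕ.* B) (λ k → 𝟙 (p ∣? (p ℕ.+ k)) * f (p ℕ.+ k)) ≡ Σ< B (λ k → f (p ℕ.* suc k))
  rest = trans (Σ-cong (p ℕ.* B) (λ k → cong (_* f (p ℕ.+ k))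
                  (𝟙-iff (λ h → ND.∣m+n∣m⇒∣n h ND.∣-refl) (ND.∣m∣n⇒∣m+n ND.∣-refl) (p ∣? (p ℕ.+ k)) (p ∣? k))))
         (trans (dilate p B (λ k → f (p ℕ.+ k)) 1≤p) (Σ-cong B (λ k → cong f (sym (ℕP.*-suc p k)))))

-- Σ_{e ∣ m} μ e = [m = 1]: for a prime p ∣ m the divisors p k with p ∤ k
-- cancel the divisors k, and the others have μ (p k) = 0.
μ-divisor-sum : ∀ m B → 1 ≤ m → m < B → DΣ B m μ ≡ 𝟙 (m ℕ.≟ 1)
μ-divisor-sum m B 1≤m m<B with m ℕ.≟ 1
... | yes refl = trans (Σ-cong B (λ e → cong (_* μ e)
                          (𝟙-iff ND.∣1⇒≡1 (λ eq → subst (_∣ 1) (sym eq) ND.∣-refl) (e ∣? 1) (e ℕ.≟ 1))))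
                       (Σ-delta B 1 μ m<B)
... | no m≢1 = trans (Σ-cong B split) (trans (Σ-+ B Mult NonMult)
               (trans (+-congʳ (Σ< B NonMult) cancel) (ℤP.+-inverseˡ (Σ< B NonMult))))
  where
  2≤m : 2 ≤ m
  2≤m = ≢1⇒≥2 1≤m m≢1
  p = proj₁ (prime-factor m 2≤m)
  pp = proj₁ (proj₂ (prime-factor m 2≤m))
  p∣m = proj₂ (proj₂ (prime-factor m 2≤m))
  1≤p : 1 ≤ p
  1≤p = ℕP.≤-trans (s≤s z≤n) (prime≥2 pp)
  Y Mult NonMult : ℕ → ℤ
  Y e       = 𝟙 (e ∣? m) * μ e
  Mult e    = 𝟙 (p ∣? e) * Y e
  NonMult e = 𝟙 (¬? (p ∣? e)) * Y e
  split : ∀ e → Y e ≡ Mult e + NonMult e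
  split e = trans (sym (ℤP.*-identityˡ (Y e)))
    (trans (cong (_* Y e) (sym (𝟙-compl (p ∣? e)))) (ℤP.*-distribʳ-+ (Y e) (𝟙 (p ∣? e)) (𝟙 (¬? (p ∣? e)))))
  paired : ∀ k → Y (p ℕ.* k) ≡ - NonMult k
  paired zero = trans (cong (λ z → Y z) (ℕP.*-zeroʳ p))
    (trans (𝟙-no-* (0∤ 1≤m) (0 ∣? m) (μ 0))
           (sym (cong -_ (*-vanishʳ (𝟙 (¬? (p ∣? 0))) (𝟙-no-* (0∤ 1≤m) (0 ∣? m) (μ 0))))))
  paired (suc k) with p ∣? suc k
  ... | yes p∣k = trans (*-vanishʳ (𝟙 ((p ℕ.* suc k) ∣? m))
                          (μ-square (p ℕ.* suc k) p (ℕP.≤-trans 1≤p (ℕP.m≤m*n p (suc k))) (prime≥2 pp)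
                                    (ND.*-monoʳ-∣ p p∣k)))
                        (sym (cong -_ (ℤP.*-zeroˡ (Y (suc k)))))
  ... | no ¬p∣k =
    trans (cong₂ _*_ (𝟙-iff (ND.∣-trans (ND.n∣m*n p)) (coprime-mul pp ¬p∣k p∣m) ((p ℕ.* suc k) ∣? m) (suc k ∣? m))
                     (μ-prime-mul p (suc k) pp (s≤s z≤n) ¬p∣k))
          (trans (sym (ℤP.neg-distribʳ-* (𝟙 (suc k ∣? m)) (μ (suc k))))
                 (cong -_ (sym (ℤP.*-identityˡ (Y (suc k))))))
  cancel : Σ< B Mult ≡ - Σ< B NonMult
  cancel = trans (sym (Σ-extend B (p ℕ.* B) Mult (ℕP.m≤n*m B p {{ℕ.>-nonZero 1≤p}})
             (λ e B≤e → *-vanishʳ (𝟙 (p ∣? e)) (𝟙-no-* (∤-large 1≤m (ℕP.<-≤-trans m<B B≤e)) (e ∣? m) (μ e)))))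
           (trans (dilate p B Y 1≤p) (trans (Σ-cong B paired) (Σ-neg B NonMult)))

ramanujan-term : ℕ → ℤ → ℕ → ℤ
ramanujan-term d l e = 𝟙 (e ∣? ℤ.∣ l ∣) * (μ (d div e) * + e)

c-as-DΣ : ∀ d l B → 1 ≤ d → d < B → c d l ≡ DΣ B d (ramanujan-term d l)
c-as-DΣ d l B 1≤d d<B =
  trans (sumℤ-filter (λ e → e ∣? ℤ.∣ l ∣) (λ e → μ (d div e) * + e) (divisors d)) (divisors-DΣ d _ B 1≤d d<B)

-- c_d(l) only depends on l through the divisors of d it has in common with l.
c-periodic : ∀ d → 1 ≤ d → Periodic d (c d)
c-periodic d 1≤d x =
  trans (c-as-DΣ d (x - + d) (suc d) 1≤d ℕP.≤-refl)
  (trans (Σ-cong (suc d) same-terms) (sym (c-as-DΣ d x (suc d) 1≤d ℕP.≤-refl)))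
  where
  cancel : ∀ a b → a - b + b ≡ a
  cancel = solve-∀
  same-terms : ∀ e → 𝟙 (e ∣? d) * ramanujan-term d (x - + d) e ≡ 𝟙 (e ∣? d) * ramanujan-term d x e
  same-terms e with e ∣? d
  ... | no _    = refl
  ... | yes e∣d = cong (λ z → 1ℤ * (z * (μ (d div e) * + e)))
    (𝟙-iff (λ h → subst (λ z → e ∣ ℤ.∣ z ∣) (cancel x (+ d)) (∣-abs-+ (x - + d) (+ d) h e∣d))
           (λ h → ∣-abs-- x (+ d) h e∣d) (e ∣? ℤ.∣ x - + d ∣) (e ∣? ℤ.∣ x ∣))

-- Σ_{e ∣ d ∣ n} μ (d / e) = [e = n], by dilating by e and μ-divisor-sum.
μ-quotient-sum : ∀ n e → 1 ≤ n → 1 ≤ e →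
  Σ< (suc n) (λ d → 𝟙 (e ∣? d) * (𝟙 (d ∣? n) * μ (d div e))) ≡ 𝟙 (e ℕ.≟ n)
μ-quotient-sum n e@(suc _) 1≤n _ =
  trans (sym (Σ-extend (suc n) (e ℕ.* suc n) W (ℕP.m≤n*m (suc n) e) beyond))
  (trans (dilate e (suc n) (λ d → 𝟙 (d ∣? n) * μ (d div e)) (s≤s z≤n))
  (trans (Σ-cong (suc n) (λ k → cong (λ z → 𝟙 ((e ℕ.* k) ∣? n) * μ z) (quotient k))) by-cases))
  where
  W : ℕ → ℤ
  W d = 𝟙 (e ∣? d) * (𝟙 (d ∣? n) * μ (d div e))
  beyond : ∀ d → suc n ≤ d → W d ≡ 0ℤ
  beyond d n<d = *-vanishʳ (𝟙 (e ∣? d)) (𝟙-no-* (∤-large 1≤n n<d) (d ∣? n) (μ (d div e)))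
  quotient : ∀ k → (e ℕ.* k) div e ≡ k
  quotient k = trans (cong (_div e) (ℕP.*-comm e k)) (div-exact k e (s≤s z≤n))
  by-cases : Σ< (suc n) (λ k → 𝟙 ((e ℕ.* k) ∣? n) * μ k) ≡ 𝟙 (e ℕ.≟ n)
  by-cases with e ∣? n
  ... | no ¬e∣n = trans (Σ-zero (suc n) (λ k → 𝟙-no-* (λ h → ¬e∣n (ND.∣-trans (ND.m∣m*n k) h))
                                                          ((e ℕ.* k) ∣? n) (μ k)))
                        (sym (𝟙-no (λ eq → ¬e∣n (subst (e ∣_) eq ND.∣-refl)) (e ℕ.≟ n)))
  ... | yes (divides q n≡qe) =
    trans (Σ-cong (suc n) (λ k → cong (_* μ k) (𝟙-iff cancel-e scale-e ((e ℕ.* k) ∣? n) (k ∣? q))))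
          (trans (μ-divisor-sum q (suc n) 1≤q q<B) (𝟙-iff q≡1⇒e≡n e≡n⇒q≡1 (q ℕ.≟ 1) (e ℕ.≟ n)))
    where
    n≡eq : n ≡ e ℕ.* q
    n≡eq = trans n≡qe (ℕP.*-comm q e)
    cancel-e : ∀ {k} → e ℕ.* k ∣ n → k ∣ q
    cancel-e h = ND.*-cancelˡ-∣ e (subst (e ℕ.* _ ∣_) n≡eq h)
    scale-e : ∀ {k} → k ∣ q → e ℕ.* k ∣ n
    scale-e h = subst (e ℕ.* _ ∣_) (sym n≡eq) (ND.*-monoʳ-∣ e h)
    1≤q : 1 ≤ q
    1≤q = factor-pos q e 1≤n n≡qe
    q<B : q < suc n
    q<B = s≤s (subst (q ≤_) (sym n≡eq) (ℕP.m≤n*m q e))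
    q≡1⇒e≡n : q ≡ 1 → e ≡ n
    q≡1⇒e≡n refl = sym (trans n≡eq (ℕP.*-identityʳ e))
    e≡n⇒q≡1 : e ≡ n → q ≡ 1
    e≡n⇒q≡1 e≡n = ℕP.*-cancelˡ-≡ q 1 e (trans (sym n≡eq) (trans (sym e≡n) (sym (ℕP.*-identityʳ e))))

-- Orthogonality of Ramanujan sums: Σ_{d ∣ n} c_d(l) = n · [n ∣ l].  Writing
-- out c_d and exchanging the two divisor sums leaves Σ_{e ∣ n, e ∣ l} e · [e = n].
ramanujan-orthogonality : ∀ n l → 1 ≤ n → sumℤ (map (λ d → c d l) (divisors n)) ≡ + n * 𝟙 (n ∣? ℤ.∣ l ∣)
ramanujan-orthogonality n l 1≤n = begin
  sumℤ (map (λ d → c d l) (divisors n))                  ≡⟨ divisors-DΣ n (λ d → c d l) B 1≤n ℕP.≤-refl ⟩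
  DΣ B n (λ d → c d l)                                   ≡⟨ Σ-cong B expand ⟩
  Σ< B (λ d → Σ< B (T d))                                ≡⟨ Σ-swap B B T ⟩
  Σ< B (λ e → Σ< B (λ d → T d e))                        ≡⟨ Σ-cong B collapse ⟩
  Σ< B (λ e → 𝟙 (e ℕ.≟ n) * (𝟙 (n ∣? ℤ.∣ l ∣) * + n))
    ≡⟨ Σ-delta B n (λ _ → 𝟙 (n ∣? ℤ.∣ l ∣) * + n) ℕP.≤-refl ⟩
  𝟙 (n ∣? ℤ.∣ l ∣) * + n                                ≡⟨ ℤP.*-comm (𝟙 (n ∣? ℤ.∣ l ∣)) (+ n) ⟩
  + n * 𝟙 (n ∣? ℤ.∣ l ∣)                                ∎
  where
  open ≡-Reasoning
  B = suc n
  T : ℕ → ℕ → ℤ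
  T d e = 𝟙 (d ∣? n) * (𝟙 (e ∣? d) * ramanujan-term d l e)
  expand : ∀ d → 𝟙 (d ∣? n) * c d l ≡ Σ< B (T d)
  expand d with d ∣? n
  ... | no _    = sym (Σ-zero B (λ e → ℤP.*-zeroˡ (𝟙 (e ∣? d) * ramanujan-term d l e)))
  ... | yes d∣n = trans (cong (1ℤ *_) (c-as-DΣ d l B (divisor-pos 1≤n d∣n) (s≤s (ND.∣⇒≤ {{ℕ.>-nonZero 1≤n}} d∣n))))
                        (sym (Σ-* B 1ℤ (λ e → 𝟙 (e ∣? d) * ramanujan-term d l e)))
  weight : ℕ → ℤ
  weight e = 𝟙 (e ∣? ℤ.∣ l ∣) * + e
  regroup : ∀ a b x m y → a * (b * (x * (m * y))) ≡ (x * y) * (b * (a * m))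
  regroup = solve-∀
  select : ∀ e → weight e * 𝟙 (e ℕ.≟ n) ≡ 𝟙 (e ℕ.≟ n) * weight n
  select e with e ℕ.≟ n
  ... | yes refl = ℤP.*-comm (weight e) 1ℤ
  ... | no _     = trans (ℤP.*-zeroʳ (weight e)) (sym (ℤP.*-zeroˡ (weight n)))
  finish : ∀ e → weight e * Σ< B (λ d → 𝟙 (e ∣? d) * (𝟙 (d ∣? n) * μ (d div e)))
                 ≡ 𝟙 (e ℕ.≟ n) * (𝟙 (n ∣? ℤ.∣ l ∣) * + n)
  finish zero = trans (cong (_* Σ< B (λ d → 𝟙 (0 ∣? d) * (𝟙 (d ∣? n) * μ (d div 0))))
                            (ℤP.*-zeroʳ (𝟙 (0 ∣? ℤ.∣ l ∣))))
                      (sym (𝟙-no-* (λ 0≡n → 0∤ 1≤n (subst (0 ∣_) 0≡n ND.∣-refl)) (0 ℕ.≟ n) (weight n)))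
  finish e@(suc _) = trans (cong (weight e *_) (μ-quotient-sum n e 1≤n (s≤s z≤n))) (select e)
  collapse : ∀ e → Σ< B (λ d → T d e) ≡ 𝟙 (e ℕ.≟ n) * (𝟙 (n ∣? ℤ.∣ l ∣) * + n)
  collapse e = trans (Σ-cong B (λ d → regroup (𝟙 (d ∣? n)) (𝟙 (e ∣? d)) (𝟙 (e ∣? ℤ.∣ l ∣)) (μ (d div e)) (+ e)))
               (trans (Σ-* B (weight e) (λ d → 𝟙 (e ∣? d) * (𝟙 (d ∣? n) * μ (d div e)))) (finish e))

Σ-residue : ∀ d .{{_ : ℕ.NonZero d}} (y : ℤ) (F : ℕ → ℤ) →
  Σ< d (λ s → 𝟙 (d ∣? ℤ.∣ y - + s ∣) * F s) ≡ F (y ℤ.% + d)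
Σ-residue d y F =
  trans (Σ-cong< d (λ s s<d → cong (_* F s) (𝟙-iff (unique s s<d) (λ { refl → divides-rem })
                                               (d ∣? ℤ.∣ y - + s ∣) (s ℕ.≟ r))))
        (Σ-delta d r F (n%d<d y (+ d)))
  where
  r = y ℤ.% + d
  cancel : ∀ a b → a + b - a ≡ b
  cancel = solve-∀
  divides-rem : d ∣ ℤ.∣ y - + r ∣
  divides-rem = subst (λ z → d ∣ ℤ.∣ z ∣)
                  (sym (trans (cong (_- + r) (a≡a%n+[a/n]*n y (+ d))) (cancel (+ r) ((y ℤ./ + d) * + d))))
                  (∣-abs-* (y ℤ./ + d) (+ d) ND.∣-refl)
  difference : ∀ a b c → a - b - (a - c) ≡ c - b
  difference = solve-∀
  unique : ∀ s → s < d → d ∣ ℤ.∣ y - + s ∣ → s ≡ r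
  unique s s<d h = sym (ℤP.+-injective (ℤP.i-j≡0⇒i≡j (+ r) (+ s) (ℤP.∣i∣≡0⇒i≡0 (small-multiple bound d∣r-s))))
    where
    d∣r-s : d ∣ ℤ.∣ + r - + s ∣
    d∣r-s = subst (λ z → d ∣ ℤ.∣ z ∣) (difference y (+ s) (+ r)) (∣-abs-- (y - + s) (y - + r) h divides-rem)
    bound : ℤ.∣ + r - + s ∣ < d
    bound = subst (_< d) (sym (cong ℤ.∣_∣ (ℤP.m-n≡m⊖n r s)))
                  (ℕP.≤-<-trans (ℤP.∣m⊝n∣≤m⊔n r s) (ℕP.⊔-lub (n%d<d y (+ d)) s<d))

periodic-sampling : ∀ d .{{_ : ℕ.NonZero d}} {g : ℤ → ℤ} → Periodic d g → ∀ t i →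
  Σ< d (λ s → 𝟙 (d ∣? ℤ.∣ + t - + s ∣) * g (i - + s)) ≡ g (i - + t)
periodic-sampling d {g} per t i =
  trans (Σ-residue d (+ t) (λ s → g (i - + s)))
  (trans (sym (periodic-multiple per (t ℕ./ d) (i - + (t ℕ.% d))))
         (cong g (trans (regroup i (+ (t ℕ.% d)) (+ (t ℕ./ d ℕ.* d)))
                        (cong (λ z → i - z) (trans (sym (ℤP.pos-+ (t ℕ.% d) _)) (cong +_ (sym (m≡m%n+[m/n]*n t d))))))))
  where
  regroup : ∀ a b c → a - b - c ≡ a - (b + c)
  regroup = solve-∀

inverse-mod-prime : ∀ p q → Prime p → ¬ p ∣ q → Σ ℤ (λ u → Σ ℤ (λ t → u * + q ≡ 1ℤ + t * + p))
inverse-mod-prime p q pp ¬p∣q with coprime-Bézout (prime-coprime pp ¬p∣q)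
... | Bézout.+- x y eq = + x , + y ,
  trans (sym (ℤP.pos-* x q)) (trans (cong +_ (sym eq)) (trans (ℤP.pos-+ 1 (y ℕ.* p)) (+-congˡ 1ℤ (ℤP.pos-* y p))))
... | Bézout.-+ x y eq = - + x , - + y ,
  trans (negate (+ x) (+ q)) (trans (cong (λ z → 1ℤ - z) pos-eq) (negate' (+ y) (+ p)))
  where
  pos-eq : 1ℤ + + x * + q ≡ + y * + p
  pos-eq = trans (+-congˡ 1ℤ (sym (ℤP.pos-* x q))) (trans (sym (ℤP.pos-+ 1 (x ℕ.* q))) (trans (cong +_ eq) (ℤP.pos-* y p)))
  negate : ∀ a b → - a * b ≡ 1ℤ - (1ℤ + a * b)
  negate = solve-∀
  negate' : ∀ c d → 1ℤ - c * d ≡ 1ℤ + - c * d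
  negate' = solve-∀

count-coarse : ∀ e w i p → e ∣ w →
  Σ< p (λ m → 𝟙 (e ∣? ℤ.∣ i - + (m ℕ.* w) ∣)) ≡ + p * 𝟙 (e ∣? ℤ.∣ i ∣)
count-coarse e w i p e∣w =
  trans (Σ-cong p (λ m → 𝟙-iff (fwd m) (λ h → ∣-abs-- i (+ (m ℕ.* w)) h (e∣mw m))
                               (e ∣? ℤ.∣ i - + (m ℕ.* w) ∣) (e ∣? ℤ.∣ i ∣)))
        (Σ-const p _)
  where
  e∣mw : ∀ m → e ∣ ℤ.∣ + (m ℕ.* w) ∣
  e∣mw m = ND.∣-trans e∣w (ND.n∣m*n m)
  cancel : ∀ a b → a - b + b ≡ a
  cancel = solve-∀
  fwd : ∀ m → e ∣ ℤ.∣ i - + (m ℕ.* w) ∣ → e ∣ ℤ.∣ i ∣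
  fwd m h = subst (λ z → e ∣ ℤ.∣ z ∣) (cancel i _) (∣-abs-+ (i - + (m ℕ.* w)) (+ (m ℕ.* w)) h (e∣mw m))

-- Along a progression of step q with p ∤ q, exactly one of p consecutive
-- points is divisible by the prime p: as u q ≡ 1 (mod p),
-- p ∣ I - m q ⇔ p ∣ u I - m, and exactly one m < p satisfies the latter.
count-prime : ∀ p q → Prime p → ¬ p ∣ q → ∀ I → Σ< p (λ m → 𝟙 (p ∣? ℤ.∣ I - + (m ℕ.* q) ∣)) ≡ 1ℤ
count-prime p q pp ¬p∣q I with inverse-mod-prime p q pp ¬p∣q
... | u , t , uq≡1+tp = begin
  Σ< p (λ m → 𝟙 (p ∣? ℤ.∣ I - + (m ℕ.* q) ∣))
    ≡⟨ Σ-cong p (λ m → trans (𝟙-iff (fwd m) (bwd m) (p ∣? ℤ.∣ I - + (m ℕ.* q) ∣) (p ∣? ℤ.∣ u * I - + m ∣))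
                             (sym (ℤP.*-identityʳ _))) ⟩
  Σ< p (λ m → 𝟙 (p ∣? ℤ.∣ u * I - + m ∣) * 1ℤ)
    ≡⟨ Σ-residue p {{prime⇒nonZero pp}} (u * I) (λ _ → 1ℤ) ⟩
  1ℤ ∎
  where
  open ≡-Reasoning
  forward-id : ∀ u I m q t p → u * q ≡ 1ℤ + t * p → u * (I - m * q) + m * t * p ≡ u * I - m
  forward-id u I m q t p h = trans (step₁ u I m q t p) (trans (cong (λ z → u * I - m * z + m * t * p) h) (step₂ u I m t p))
    where
    step₁ : ∀ u I m q t p → u * (I - m * q) + m * t * p ≡ u * I - m * (u * q) + m * t * p
    step₁ = solve-∀
    step₂ : ∀ u I m t p → u * I - m * (1ℤ + t * p) + m * t * p ≡ u * I - m
    step₂ = solve-∀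
  backward-id : ∀ q u I m t p → u * q ≡ 1ℤ + t * p → q * (u * I - m) - t * I * p ≡ I - m * q
  backward-id q u I m t p h = trans (step₁ q u I m t p) (trans (cong (λ z → z * I - m * q - t * I * p) h) (step₂ I m q t p))
    where
    step₁ : ∀ q u I m t p → q * (u * I - m) - t * I * p ≡ u * q * I - m * q - t * I * p
    step₁ = solve-∀
    step₂ : ∀ I m q t p → (1ℤ + t * p) * I - m * q - t * I * p ≡ I - m * q
    step₂ = solve-∀
  fwd : ∀ m → p ∣ ℤ.∣ I - + (m ℕ.* q) ∣ → p ∣ ℤ.∣ u * I - + m ∣
  fwd m h = subst (λ z → p ∣ ℤ.∣ z ∣)
    (trans (cong (λ z → u * (I - z) + + m * t * + p) (ℤP.pos-* m q)) (forward-id u I (+ m) (+ q) t (+ p) uq≡1+tp))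
    (∣-abs-+ (u * (I - + (m ℕ.* q))) (+ m * t * + p) (∣-abs-* u _ h) (∣-abs-* (+ m * t) (+ p) ND.∣-refl))
  bwd : ∀ m → p ∣ ℤ.∣ u * I - + m ∣ → p ∣ ℤ.∣ I - + (m ℕ.* q) ∣
  bwd m h = subst (λ z → p ∣ ℤ.∣ z ∣)
    (trans (backward-id (+ q) u I (+ m) t (+ p) uq≡1+tp) (cong (λ z → I - z) (sym (ℤP.pos-* m q))))
    (∣-abs-- (+ q * (u * I - + m)) (t * I * + p) (∣-abs-* (+ q) _ h) (∣-abs-* (t * I) (+ p) ND.∣-refl))

count-fine : ∀ p k q i → 1 ≤ k → Prime p → ¬ p ∣ q →
  Σ< p (λ m → 𝟙 ((p ℕ.* k) ∣? ℤ.∣ i - + (m ℕ.* (q ℕ.* k)) ∣)) ≡ 𝟙 (k ∣? ℤ.∣ i ∣)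
count-fine p k q i 1≤k pp ¬p∣q with k ∣? ℤ.∣ i ∣
... | no ¬k∣i = Σ-zero p (λ m → 𝟙-no (λ h → ¬k∣i (k∣i m (ND.∣-trans (ND.n∣m*n p) h)))
                                   ((p ℕ.* k) ∣? ℤ.∣ i - + (m ℕ.* (q ℕ.* k)) ∣))
  where
  cancel : ∀ a b → a - b + b ≡ a
  cancel = solve-∀
  k∣i : ∀ m → k ∣ ℤ.∣ i - + (m ℕ.* (q ℕ.* k)) ∣ → k ∣ ℤ.∣ i ∣
  k∣i m h = subst (λ z → k ∣ ℤ.∣ z ∣) (cancel i _)
              (∣-abs-+ (i - + (m ℕ.* (q ℕ.* k))) (+ (m ℕ.* (q ℕ.* k))) h (ND.∣-trans (ND.n∣m*n q) (ND.n∣m*n m)))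
... | yes k∣i with Signed.∣ᵤ⇒∣ {+ k} {i} k∣i
...   | Signed.divides I i≡Ik =
  trans (Σ-cong p (λ m → 𝟙-iff (fwd m) (bwd m)
                               ((p ℕ.* k) ∣? ℤ.∣ i - + (m ℕ.* (q ℕ.* k)) ∣) (p ∣? ℤ.∣ I - + (m ℕ.* q) ∣)))
        (count-prime p q pp ¬p∣q I)
  where
  factor : ∀ a b c → a * c - b * c ≡ (a - b) * c
  factor = solve-∀
  scaled : ∀ m → ℤ.∣ i - + (m ℕ.* (q ℕ.* k)) ∣ ≡ ℤ.∣ I - + (m ℕ.* q) ∣ ℕ.* k
  scaled m = trans (cong ℤ.∣_∣ (trans (cong₂ _-_ i≡Ik (trans (cong +_ (sym (ℕP.*-assoc m q k))) (ℤP.pos-* (m ℕ.* q) k)))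
                                      (factor I (+ (m ℕ.* q)) (+ k))))
                   (ℤP.abs-* (I - + (m ℕ.* q)) (+ k))
  fwd : ∀ m → p ℕ.* k ∣ ℤ.∣ i - + (m ℕ.* (q ℕ.* k)) ∣ → p ∣ ℤ.∣ I - + (m ℕ.* q) ∣
  fwd m h = ND.*-cancelʳ-∣ k {{ℕ.>-nonZero 1≤k}} (subst (p ℕ.* k ∣_) (scaled m) h)
  bwd : ∀ m → p ∣ ℤ.∣ I - + (m ℕ.* q) ∣ → p ℕ.* k ∣ ℤ.∣ i - + (m ℕ.* (q ℕ.* k)) ∣
  bwd m h = subst (p ℕ.* k ∣_) (sym (scaled m)) (ND.*-monoˡ-∣ k h)

-- Expanding c_d, the
-- divisor e of d is weighted by the number of points of the progression it
-- divides.  Divisors e ∣ w with w / e prime to p cancel against p e, and the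
-- remaining divisors e ∣ w carry μ (d / e) = 0.
module RamanujanBalance {d p w : ℕ} (pp : Prime p) (d≡pw : d ≡ p ℕ.* w) (1≤w : 1 ≤ w) (i : ℤ) where

  1≤p : 1 ≤ p
  1≤p = ℕP.≤-trans (s≤s z≤n) (prime≥2 pp)

  1≤d : 1 ≤ d
  1≤d = subst (1 ≤_) (sym d≡pw) (ℕP.≤-trans 1≤w (ℕP.m≤n*m w p {{ℕ.>-nonZero 1≤p}}))

  B : ℕ
  B = suc d

  count : ℕ → ℤ
  count e = Σ< p (λ m → 𝟙 (e ∣? ℤ.∣ i - + (m ℕ.* w) ∣))

  V : ℕ → ℤ
  V e = count e * (𝟙 (e ∣? d) * (μ (d div e) * + e))

  progression-sum : Σ< p (λ m → c d (i - + (m ℕ.* w))) ≡ Σ< B V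
  progression-sum =
    trans (Σ-cong p (λ m → c-as-DΣ d (i - + (m ℕ.* w)) B 1≤d ℕP.≤-refl))
    (trans (Σ-swap p B (λ m e → 𝟙 (e ∣? d) * ramanujan-term d (i - + (m ℕ.* w)) e))
           (Σ-cong B pull-out))
    where
    swap : ∀ a b x → a * (b * x) ≡ b * (a * x)
    swap = solve-∀
    pull-out : ∀ e → Σ< p (λ m → 𝟙 (e ∣? d) * ramanujan-term d (i - + (m ℕ.* w)) e) ≡ V e
    pull-out e = trans (Σ-cong p (λ m → swap (𝟙 (e ∣? d)) (𝟙 (e ∣? ℤ.∣ i - + (m ℕ.* w) ∣)) (μ (d div e) * + e)))
                       (Σ-*ʳ p (𝟙 (e ∣? d) * (μ (d div e) * + e)) (λ m → 𝟙 (e ∣? ℤ.∣ i - + (m ℕ.* w) ∣)))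

  V-nondivisor : ∀ e → ¬ e ∣ d → V e ≡ 0ℤ
  V-nondivisor e ¬e∣d = *-vanishʳ (count e) (𝟙-no-* ¬e∣d (e ∣? d) (μ (d div e) * + e))

  -- A divisor of d = p w not dividing w is a multiple p k of p.
  nondividing-part : Σ< B (λ e → 𝟙 (¬? (e ∣? w)) * V e) ≡ Σ< B (λ k → 𝟙 (¬? ((p ℕ.* k) ∣? w)) * V (p ℕ.* k))
  nondividing-part =
    trans (Σ-cong B only-multiples)
    (trans (sym (Σ-extend B (p ℕ.* B) (λ e → 𝟙 (p ∣? e) * (𝟙 (¬? (e ∣? w)) * V e))
                          (ℕP.m≤n*m B p {{ℕ.>-nonZero 1≤p}}) beyond))
           (dilate p B (λ e → 𝟙 (¬? (e ∣? w)) * V e) 1≤p))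
    where
    only-multiples : ∀ e → 𝟙 (¬? (e ∣? w)) * V e ≡ 𝟙 (p ∣? e) * (𝟙 (¬? (e ∣? w)) * V e)
    nonmultiple : ∀ e → ¬ p ∣ e → Dec (e ∣ d) → 𝟙 (¬? (e ∣? w)) * V e ≡ 0ℤ
    nonmultiple e _    (no ¬e∣d) = *-vanishʳ (𝟙 (¬? (e ∣? w))) (V-nondivisor e ¬e∣d)
    nonmultiple e ¬p∣e (yes e∣d) =
      𝟙-no-* (λ ¬e∣w → ¬e∣w (coprime-divisor (prime-coprime pp ¬p∣e) (subst (e ∣_) d≡pw e∣d))) (¬? (e ∣? w)) (V e)
    only-multiples e with p ∣? e
    ... | yes _   = sym (ℤP.*-identityˡ _)
    ... | no ¬p∣e = trans (nonmultiple e ¬p∣e (e ∣? d)) (sym (ℤP.*-zeroˡ (𝟙 (¬? (e ∣? w)) * V e)))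
    beyond : ∀ e → B ≤ e → 𝟙 (p ∣? e) * (𝟙 (¬? (e ∣? w)) * V e) ≡ 0ℤ
    beyond e B≤e = *-vanishʳ (𝟙 (p ∣? e)) (*-vanishʳ (𝟙 (¬? (e ∣? w))) (V-nondivisor e (∤-large 1≤d B≤e)))

  cofactor-k : ∀ {q k} → 1 ≤ k → w ≡ q ℕ.* k → d div k ≡ p ℕ.* q
  cofactor-k {q} {k} 1≤k w≡qk =
    trans (cong (_div k) (trans d≡pw (trans (cong (p ℕ.*_) w≡qk) (sym (ℕP.*-assoc p q k))))) (div-exact (p ℕ.* q) k 1≤k)

  cofactor-pk : ∀ {q k} → 1 ≤ k → w ≡ q ℕ.* k → d div (p ℕ.* k) ≡ q
  cofactor-pk {q} {k} 1≤k w≡qk =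
    trans (cong (_div (p ℕ.* k)) (trans d≡pw (trans (cong (p ℕ.*_) w≡qk) (regroup p q k))))
          (div-exact q (p ℕ.* k) (ℕP.≤-trans 1≤k (ℕP.m≤n*m k p {{ℕ.>-nonZero 1≤p}})))
    where
    regroup : ∀ p q k → p ℕ.* (q ℕ.* k) ≡ q ℕ.* (p ℕ.* k)
    regroup = solveℕ-∀

  -- For w = q k with p ∣ q, μ (d / k) = μ (p q) = 0 and p k ∣ w: both terms vanish.
  pair-square : ∀ {q k} → 1 ≤ k → w ≡ q ℕ.* k → p ∣ q → V k + 𝟙 (¬? ((p ℕ.* k) ∣? w)) * V (p ℕ.* k) ≡ 0ℤ
  pair-square {q} {k} 1≤k w≡qk p∣q =
    cong₂ _+_ (*-vanishʳ (count k) (*-vanishʳ (𝟙 (k ∣? d)) μ-vanishes))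
              (𝟙-no-* (λ ¬pk∣w → ¬pk∣w pk∣w) (¬? ((p ℕ.* k) ∣? w)) (V (p ℕ.* k)))
    where
    1≤q = factor-pos q k 1≤w w≡qk
    μ-vanishes : μ (d div k) * + k ≡ 0ℤ
    μ-vanishes = trans (cong (λ z → μ z * + k) (cofactor-k {q} 1≤k w≡qk))
                 (trans (cong (_* + k) (μ-square (p ℕ.* q) p (ℕP.≤-trans 1≤q (ℕP.m≤n*m q p {{ℕ.>-nonZero 1≤p}}))
                                          (prime≥2 pp) (ND.*-monoʳ-∣ p p∣q)))
                        (ℤP.*-zeroˡ (+ k)))
    pk∣w : p ℕ.* k ∣ w
    pk∣w = subst (p ℕ.* k ∣_) (sym w≡qk) (ND.*-monoˡ-∣ k p∣q)

  -- For w = q k with p ∤ q, V k = -p [k ∣ i] μ(q) k and V (p k) = [k ∣ i] μ(q) p k.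
  pair-coprime : ∀ {q k} → 1 ≤ k → w ≡ q ℕ.* k → ¬ p ∣ q → V k + V (p ℕ.* k) ≡ 0ℤ
  pair-coprime {q} {k} 1≤k w≡qk ¬p∣q = trans (cong₂ _+_ V-k V-pk) (opposite (+ p) (𝟙 (k ∣? ℤ.∣ i ∣)) (μ q) (+ k))
    where
    1≤q = factor-pos q k 1≤w w≡qk
    k∣w : k ∣ w
    k∣w = divides q w≡qk
    k∣d : k ∣ d
    k∣d = ND.∣-trans k∣w (subst (w ∣_) (sym d≡pw) (ND.n∣m*n p))
    V-k : V k ≡ (+ p * 𝟙 (k ∣? ℤ.∣ i ∣)) * (1ℤ * (- μ q * + k))
    V-k = cong₂ _*_ (count-coarse k w i p k∣w)
            (cong₂ _*_ (𝟙-yes k∣d (k ∣? d))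
                       (cong (_* + k) (trans (cong μ (cofactor-k {q} 1≤k w≡qk)) (μ-prime-mul p q pp 1≤q ¬p∣q))))
    V-pk : V (p ℕ.* k) ≡ 𝟙 (k ∣? ℤ.∣ i ∣) * (1ℤ * (μ q * (+ p * + k)))
    V-pk = cong₂ _*_ (trans (cong (λ z → Σ< p (λ m → 𝟙 ((p ℕ.* k) ∣? ℤ.∣ i - + (m ℕ.* z) ∣))) w≡qk)
                            (count-fine p k q i 1≤k pp ¬p∣q))
             (cong₂ _*_ (𝟙-yes (subst (p ℕ.* k ∣_) (sym d≡pw) (ND.*-monoʳ-∣ p k∣w)) ((p ℕ.* k) ∣? d))
                        (cong₂ _*_ (cong μ (cofactor-pk {q} 1≤k w≡qk)) (ℤP.pos-* p k)))
    opposite : ∀ P J M K → (P * J) * (1ℤ * (- M * K)) + J * (1ℤ * (M * (P * K))) ≡ 0ℤ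
    opposite = solve-∀

  pair-cancel : ∀ k → (k∣w? : Dec (k ∣ w)) → 𝟙 k∣w? * V k + 𝟙 (¬? ((p ℕ.* k) ∣? w)) * V (p ℕ.* k) ≡ 0ℤ
  pair-cancel zero k∣w? =
    cong₂ _+_ (*-vanishʳ (𝟙 k∣w?) (V-nondivisor 0 (0∤ 1≤d)))
              (*-vanishʳ (𝟙 (¬? ((p ℕ.* 0) ∣? w)))
                         (V-nondivisor (p ℕ.* 0) (λ h → 0∤ 1≤d (subst (_∣ d) (ℕP.*-zeroʳ p) h))))
  pair-cancel k@(suc _) (no ¬k∣w) =
    cong₂ _+_ (ℤP.*-zeroˡ (V k))
              (*-vanishʳ (𝟙 (¬? ((p ℕ.* k) ∣? w)))
                         (V-nondivisor (p ℕ.* k)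
                           (λ h → ¬k∣w (ND.*-cancelˡ-∣ p {{ℕ.>-nonZero 1≤p}} (subst (p ℕ.* k ∣_) d≡pw h)))))
  pair-cancel k@(suc _) (yes (divides q w≡qk)) with p ∣? q
  ... | yes p∣q = trans (+-congʳ _ (ℤP.*-identityˡ (V k))) (pair-square (s≤s z≤n) w≡qk p∣q)
  ... | no ¬p∣q =
    trans (cong₂ _+_ (ℤP.*-identityˡ (V k))
                     (trans (cong (_* V (p ℕ.* k)) (𝟙-yes pk∤w (¬? ((p ℕ.* k) ∣? w)))) (ℤP.*-identityˡ (V (p ℕ.* k)))))
          (pair-coprime (s≤s z≤n) w≡qk ¬p∣q)
    where
    pk∤w : ¬ p ℕ.* k ∣ w
    pk∤w h = ¬p∣q (ND.*-cancelʳ-∣ k (subst (p ℕ.* k ∣_) w≡qk h))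

  balanced : Σ< p (λ m → c d (i - + (m ℕ.* w))) ≡ 0ℤ
  balanced = begin
    Σ< p (λ m → c d (i - + (m ℕ.* w)))              ≡⟨ progression-sum ⟩
    Σ< B V                                           ≡⟨ Σ-cong B split ⟩
    Σ< B (λ e → 𝟙 (e ∣? w) * V e + 𝟙 (¬? (e ∣? w)) * V e)
      ≡⟨ Σ-+ B (λ e → 𝟙 (e ∣? w) * V e) (λ e → 𝟙 (¬? (e ∣? w)) * V e) ⟩
    Σ< B (λ e → 𝟙 (e ∣? w) * V e) + Σ< B (λ e → 𝟙 (¬? (e ∣? w)) * V e)
      ≡⟨ +-congˡ (Σ< B (λ e → 𝟙 (e ∣? w) * V e)) nondividing-part ⟩
    Σ< B (λ e → 𝟙 (e ∣? w) * V e) + Σ< B (λ k → 𝟙 (¬? ((p ℕ.* k) ∣? w)) * V (p ℕ.* k))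
      ≡⟨ Σ-+ B (λ e → 𝟙 (e ∣? w) * V e) (λ k → 𝟙 (¬? ((p ℕ.* k) ∣? w)) * V (p ℕ.* k)) ⟨
    Σ< B (λ k → 𝟙 (k ∣? w) * V k + 𝟙 (¬? ((p ℕ.* k) ∣? w)) * V (p ℕ.* k))
      ≡⟨ Σ-zero B (λ k → pair-cancel k (k ∣? w)) ⟩
    0ℤ                                               ∎
    where
    open ≡-Reasoning
    split : ∀ e → V e ≡ 𝟙 (e ∣? w) * V e + 𝟙 (¬? (e ∣? w)) * V e
    split e = trans (sym (ℤP.*-identityˡ (V e)))
      (trans (cong (_* V e) (sym (𝟙-compl (e ∣? w)))) (ℤP.*-distribʳ-+ (V e) (𝟙 (e ∣? w)) (𝟙 (¬? (e ∣? w)))))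

c-balanced : ∀ d p w → Prime p → d ≡ p ℕ.* w → Balanced p w (c d)
c-balanced d p zero    pp d≡pw i rewrite d≡pw | ℕP.*-zeroʳ p = Σ-zero p (λ _ → refl)
c-balanced d p (suc w) pp d≡pw i = RamanujanBalance.balanced pp d≡pw (s≤s z≤n) i

subset-sum-expansion : ∀ n j i → 0 < n → + n * 𝐒 n i (N j) ≡ sumℤ (map (λ d → Σ⊆ j (c d) i) (divisors n))
subset-sum-expansion n j i 0<n = begin
  + n * 𝐒 n i (N j)                                             ≡⟨ cong (+ n *_) (𝐒-ev n i (N j)) ⟩
  + n * ev (N j) (λ t → 𝟙 (n ∣? ℤ.∣ + t - i ∣))                 ≡⟨ ev-* (N j) (+ n) _ ⟨
  ev (N j) (λ t → + n * 𝟙 (n ∣? ℤ.∣ + t - i ∣))                 ≡⟨ ev-cong (N j) orthogonality ⟩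
  ev (N j) (λ t → sumℤ (map (λ d → c d (i - + t)) (divisors n)))
    ≡⟨ ev-sumℤ (N j) (divisors n) (λ d t → c d (i - + t)) ⟩
  sumℤ (map (λ d → ev (N j) (λ t → c d (i - + t))) (divisors n))  ≡⟨ sumℤ-cong (divisors n) (λ d → ev-N j (c d) i) ⟩
  sumℤ (map (λ d → Σ⊆ j (c d) i) (divisors n))                   ∎
  where
  open ≡-Reasoning
  orthogonality : ∀ t → + n * 𝟙 (n ∣? ℤ.∣ + t - i ∣) ≡ sumℤ (map (λ d → c d (i - + t)) (divisors n))
  orthogonality t = trans (cong (λ z → + n * 𝟙 (n ∣? z)) (ℤP.∣i-j∣≡∣j-i∣ (+ t) i))
                          (sym (ramanujan-orthogonality n (i - + t) 0<n))

inner-sum : ∀ d r i → 1 ≤ d →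
  sumℤ (map (λ s → 𝐒 d (+ s) (N r) * c d (i - + s)) (upTo d)) ≡ Σ⊆ r (c d) i
inner-sum d@(suc _) r i 1≤d = begin
  sumℤ (map (λ s → 𝐒 d (+ s) (N r) * c d (i - + s)) (upTo d))
    ≡⟨ sumℤ-applyUpTo d (λ s → s) (λ s → 𝐒 d (+ s) (N r) * c d (i - + s)) ⟩
  Σ< d (λ s → 𝐒 d (+ s) (N r) * c d (i - + s))
    ≡⟨ Σ-cong d as-evaluation ⟩
  Σ< d (λ s → ev (N r) (λ t → 𝟙 (d ∣? ℤ.∣ + t - + s ∣) * c d (i - + s)))
    ≡⟨ ev-Σ< (N r) d (λ s t → 𝟙 (d ∣? ℤ.∣ + t - + s ∣) * c d (i - + s)) ⟨
  ev (N r) (λ t → Σ< d (λ s → 𝟙 (d ∣? ℤ.∣ + t - + s ∣) * c d (i - + s)))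
    ≡⟨ ev-cong (N r) (λ t → periodic-sampling d (c-periodic d 1≤d) t i) ⟩
  ev (N r) (λ t → c d (i - + t))
    ≡⟨ ev-N r (c d) i ⟩
  Σ⊆ r (c d) i ∎
  where
  open ≡-Reasoning
  as-evaluation : ∀ s → 𝐒 d (+ s) (N r) * c d (i - + s) ≡ ev (N r) (λ t → 𝟙 (d ∣? ℤ.∣ + t - + s ∣) * c d (i - + s))
  as-evaluation s =
    trans (cong (_* c d (i - + s)) (𝐒-ev d (+ s) (N r)))
    (trans (ℤP.*-comm _ (c d (i - + s)))
    (trans (sym (ev-* (N r) (c d (i - + s)) _)) (ev-cong (N r) (λ t → ℤP.*-comm (c d (i - + s)) _))))

-- Even divisors d of n ≤ j do not contribute: c_d is antiperiodic with
-- antiperiod d / 2 ≤ j (balance for the prime 2).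
even-divisor-vanishes : ∀ n j d i → d ∣ n → 1 ≤ n → n ≤ j → 2 ∣ d → Σ⊆ j (c d) i ≡ 0ℤ
even-divisor-vanishes n j d i d∣n 1≤n n≤j (divides zero d≡0) = ⊥-elim (0∤ 1≤n (subst (_∣ n) d≡0 d∣n))
even-divisor-vanishes n j d i d∣n 1≤n n≤j (divides k@(suc k') d≡k2) = Σ⊆-antiperiodic (c d) k' antiperiodic j k'<j i
  where
  antiperiodic : ∀ x → c d x + c d (x - + k) ≡ 0ℤ
  antiperiodic x = trans (cong₂ _+_ (cong (c d) (sym (ℤP.+-identityʳ x)))
                                   (trans (cong (λ z → c d (x - + z)) (sym (ℕP.*-identityˡ k))) (sym (ℤP.+-identityʳ _))))
                         (c-balanced d 2 k prime[2] (trans d≡k2 (ℕP.*-comm k 2)) x)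
  k'<j : k' < j
  k'<j = ℕP.≤-trans (subst (k ≤_) (sym d≡k2) (ℕP.m≤m*n k 2))
                    (ℕP.≤-trans (ND.∣⇒≤ {{ℕ.>-nonZero 1≤n}} d∣n) n≤j)

odd-form : ∀ d → ¬ 2 ∣ d → d ≡ suc ((d ℕ./ 2) ℕ.* 2)
odd-form d ¬2∣d with d ℕ.% 2 in eq | m%n<n d 2
... | zero        | _ = ⊥-elim (¬2∣d (ND.m%n≡0⇒n∣m d 2 eq))
... | suc zero    | _ = trans (m≡m%n+[m/n]*n d 2) (cong (ℕ._+ (d ℕ./ 2) ℕ.* 2) eq)
... | suc (suc _) | s≤s (s≤s ())

odd-divisor-reduction : ∀ d j i → ¬ 2 ∣ d → Σ⊆ j (c d) i ≡ (+ 2) ^ (j div d) * Σ⊆ (j mod d) (c d) i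
odd-divisor-reduction d j i ¬2∣d rewrite odd-form d ¬2∣d =
  trans (cong (λ z → Σ⊆ z (c D) i) (trans (m≡m%n+[m/n]*n j D) (ℕP.+-comm (j ℕ.% D) _)))
        (Σ⊆-doubling D per (Σ⊆-odd-period a per (c-balanced D)) (j ℕ./ D) (j ℕ.% D) i)
  where
  a = d ℕ./ 2
  D = suc (a ℕ.* 2)
  per = c-periodic D (s≤s z≤n)

divisors-divide : ∀ n → All (_∣ n) (divisors n)
divisors-divide n = filter-All (λ e → e ∣? n) (map suc (upTo n))

odd-divisors-suffice : ∀ n j i → 0 < n → n ≤ j →
  sumℤ (map (λ d → Σ⊆ j (c d) i) (oddDivisors n)) ≡ sumℤ (map (λ d → Σ⊆ j (c d) i) (divisors n))
odd-divisors-suffice n j i 0<n n≤j =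
  trans (sumℤ-filter (λ d → ¬? (2 ∣? d)) (λ d → Σ⊆ j (c d) i) (divisors n))
        (sumℤ-cong-All (divisors-divide n) (λ d d∣n → drop-even d d∣n (2 ∣? d)))
  where
  drop-even : ∀ d → d ∣ n → (even? : Dec (2 ∣ d)) → 𝟙 (¬? even?) * Σ⊆ j (c d) i ≡ Σ⊆ j (c d) i
  drop-even d d∣n (yes 2∣d) = trans (ℤP.*-zeroˡ (Σ⊆ j (c d) i)) (sym (even-divisor-vanishes n j d i d∣n 0<n n≤j 2∣d))
  drop-even d d∣n (no _)    = ℤP.*-identityˡ _

theorem4p5 : (n j : ℕ) (i : ℤ) → 0 < n → n ≤ j →
    (+ n) * 𝐒 n i (N j)
      ≡ sumℤ (map (λ d → ((+ 2) ^ (j div d)) *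
                     sumℤ (map (λ s → 𝐒 d (+ s) (N (j mod d)) * c d (i - + s)) (upTo d)))
                  (oddDivisors n))
theorem4p5 n j i 0<n n≤j = begin
  + n * 𝐒 n i (N j)                                 ≡⟨ subset-sum-expansion n j i 0<n ⟩
  sumℤ (map (λ d → Σ⊆ j (c d) i) (divisors n))      ≡⟨ odd-divisors-suffice n j i 0<n n≤j ⟨
  sumℤ (map (λ d → Σ⊆ j (c d) i) (oddDivisors n))   ≡⟨ sumℤ-cong-All odd-divisors reduce ⟩
  sumℤ (map (λ d → (+ 2) ^ (j div d) * sumℤ (map (λ s → 𝐒 d (+ s) (N (j mod d)) * c d (i - + s)) (upTo d)))
            (oddDivisors n))                        ∎
  where
  open ≡-Reasoning
  odd-divisors : All (λ d → d ∣ n × ¬ 2 ∣ d) (oddDivisors n)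
  odd-divisors = filter-All-pair (λ d → ¬? (2 ∣? d)) (divisors-divide n)
  reduce : ∀ d → d ∣ n × ¬ 2 ∣ d →
    Σ⊆ j (c d) i ≡ (+ 2) ^ (j div d) * sumℤ (map (λ s → 𝐒 d (+ s) (N (j mod d)) * c d (i - + s)) (upTo d))
  reduce d (d∣n , odd) = trans (odd-divisor-reduction d j i odd)
                               (cong ((+ 2) ^ (j div d) *_) (sym (inner-sum d (j mod d) i (divisor-pos 0<n d∣n))))
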